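{- Let $T$ be an abundant acyclic quiver with reddening source sequence $\mathbf S$, and let $\mathbf M$ be a mutation sequence of vertices of $T$ such that $\mathbf M^{ -1}\mathbf S\mathbf M$ is reduced. Then every nonzero nonnegative integer matrix $A$ with $|T|$ rows is distinguishing for the mutation sequence $[\mu_{\mathbf M}(T)]_{\mathbf M^{ -1}\mathbf S\mathbf M}$.
   Context: A quiver is a finite directed graph with labeled vertices, multiple arrows allowed, with no loops and no directed $2$-cycles; equality means equality of labeled graphs. $b_{xy}$ is the number of arrows $x\to y$ minus the number of arrows $y\to x$. A quiver is abundant if $|b_{ij}|\ge 2$ for all distinct $i,j$, and acyclic if it has no oriented cycles. Mutation $\mu_i$: for each path $u\to i\to v$ add an arrow $u\to v$; reverse all arrows at $i$; delete a maximal collection of oriented $2$-cycles; $\mu_{\mathbf i}=\mu_{i_m}\circ\cdots\circ\mu_{i_1}$ for $\mathbf i=i_1,\dots,i_m$; $\mathbf i^{ -1}=i_m,\dots,i_1$; juxtaposition is concatenation; a sequence is reduced if no two consecutive entries are equal. For a quiver $P$, $[P]_{\mathbf i}$ denotes the list $P,\mu_{i_1}(P),\dots,\mu_{\mathbf i}(P)$. The framed quiver $\widehat Q$ adds a frozen vertex $i'$ and an arrow $i\to i'$ for each vertex $i$; mutations only at mutable vertices. A reddening sequence for $Q$ is a sequence such that every mutable vertex $j$ of the resulting mutation of $\widehat Q$ satisfies $b_{ji'}\le0$ for all frozen $i'$. A source sequence of an acyclic quiver is a sequence $v_1,\dots,v_k$ such that any arrow $v_i\to v_j$ has $i<j$;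 a reddening source sequence is a source sequence that is also a reddening sequence. For quivers $T',H'$ on disjoint vertex sets and a nonnegative integer $|T'|\times|H'|$ matrix $A=(a_{th})$, $T'\stackrel{A}{\rightarrow}H'$ is the quiver containing $T'$, $H'$ as full subquivers with exactly $a_{th}$ arrows $t\to h$ and no other arrows between them. $I_k$ is the quiver with $k$ vertices and no arrows. For a quiver $P$ and mutation sequence $\mathbf i$ of its vertices, a nonnegative integer $|P|\times k$ matrix $A$ is distinguishing for $[P]_{\mathbf i}$ if the quivers in the list $[P\stackrel{A}{\rightarrow}I_k]_{\mathbf i}$ are pairwise distinct. -}

module Defs where

open import Data.Nat using (ℕ; zero; suc; _+_; _*_; _∸_; _<_)
open import Data.Integer using (ℤ; _⊖_; ∣_∣) renaming (_≤_ to _≤ℤ_)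
open import Data.Integer using () renaming (0ℤ to 0ℤ)
open import Data.Fin using (Fin; toℕ; _↑ˡ_; _↑ʳ_; splitAt; _≟_)
open import Data.List using (List; []; _∷_; length; lookup; map)
open import Data.Sum using (_⊎_; inj₁; inj₂)
open import Data.Product using (_×_; ∃; ∃-syntax)
open import Data.Bool using (if_then_else_; _∨_)
open import Relation.Nullary using (¬_; does)
open import Relation.Binary.PropositionalEquality using (_≡_; _≢_)
open import Data.List.Relation.Unary.AllPairs using (AllPairs)
open import Data.List.Relation.Unary.Linked using (Linked)

-- A (labeled) quiver on vertex set Fin n is given by its arrow counts:
-- Q x y = number of arrows x → y.
Arrows : ℕ → Set
Arrows n = Fin n → Fin n → ℕ

IsQuiver : ∀ {n} → Arrows n → Set
IsQuiver {n} Q = (∀ x → Q x x ≡ 0) × (∀ x y → Q x y ≡ 0 ⊎ Q y x ≡ 0)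

_≈Q_ : ∀ {n} → Arrows n → Arrows n → Set
P ≈Q Q = ∀ x y → P x y ≡ Q x y

_≉Q_ : ∀ {n} → Arrows n → Arrows n → Set
P ≉Q Q = ¬ (P ≈Q Q)

b : ∀ {n} → Arrows n → Fin n → Fin n → ℤ
b Q x y = Q x y ⊖ Q y x

Abundant : ∀ {n} → Arrows n → Set
Abundant {n} Q = ∀ (i j : Fin n) → i ≢ j → 2 Data.Nat.≤ ∣ b Q i j ∣

data Path⁺ {n} (Q : Arrows n) : Fin n → Fin n → Set where
  edge : ∀ {x y} → 0 < Q x y → Path⁺ Q x y
  cons : ∀ {x y z} → 0 < Q x y → Path⁺ Q y z → Path⁺ Q x z

Acyclic : ∀ {n} → Arrows n → Set
Acyclic {n} Q = ∀ (x : Fin n) → ¬ Path⁺ Q x x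

-- mutation at k: add u→v for each path u→k→v, reverse arrows at k,
-- delete a maximal collection of oriented 2-cycles.
μ : ∀ {n} → Fin n → Arrows n → Arrows n
μ k Q x y =
  if does (x ≟ k) ∨ does (y ≟ k)
  then Q y x
  else (Q x y + Q x k * Q k y) ∸ (Q y x + Q y k * Q k x)

μs : ∀ {n} → List (Fin n) → Arrows n → Arrows n
μs [] Q = Q
μs (i ∷ is) Q = μs is (μ i Q)

traj : ∀ {n} → List (Fin n) → Arrows n → List (Arrows n)
traj [] P = P ∷ []
traj (i ∷ is) P = P ∷ traj is (μ i P)

Reduced : ∀ {n} → List (Fin n) → Set
Reduced = Linked _≢_

-- T' →A H' on vertex set Fin (n + k): first n vertices are T', last k are H'
glue : ∀ {n k} → Arrows n → Arrows k → (Fin n → Fin k → ℕ) → Arrows (n + k)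
glue {n} T H A x y with splitAt n x | splitAt n y
... | inj₁ t | inj₁ t' = T t t'
... | inj₂ h | inj₂ h' = H h h'
... | inj₁ t | inj₂ h  = A t h
... | inj₂ _ | inj₁ _  = 0

I : ∀ k → Arrows k
I k _ _ = 0

idMat : ∀ {n} → Fin n → Fin n → ℕ
idMat i j = if does (i ≟ j) then 1 else 0

-- framed quiver: vertex i ↦ i ↑ˡ n (mutable), i' ↦ n ↑ʳ i (frozen)
framed : ∀ {n} → Arrows n → Arrows (n + n)
framed {n} Q = glue Q (I n) idMat

Reddening : ∀ {n} → Arrows n → List (Fin n) → Set
Reddening {n} Q S =
  ∀ (j i : Fin n) →
    b (μs (map (_↑ˡ n) S) (framed Q)) (j ↑ˡ n) (n ↑ʳ i) ≤ℤ 0ℤ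

SourceSequence : ∀ {n} → Arrows n → List (Fin n) → Set
SourceSequence Q S =
  ∀ (i j : Fin (length S)) → 0 < Q (lookup S i) (lookup S j) → toℕ i < toℕ j

ReddeningSourceSequence : ∀ {n} → Arrows n → List (Fin n) → Set
ReddeningSourceSequence Q S = SourceSequence Q S × Reddening Q S

NonzeroMat : ∀ {n k} → (Fin n → Fin k → ℕ) → Set
NonzeroMat A = ∃[ t ] ∃[ h ] 0 < A t h

Distinguishing : ∀ {n k} → Arrows n → List (Fin n) → (Fin n → Fin k → ℕ) → Set
Distinguishing {n} {k} P is A = AllPairs _≉Q_ (traj (map (_↑ˡ k) is) (glue P (I k) A))

-- Let Y = μ_{M⁻¹}(μ_M(T) →A I_k) and Y′ = μ_S(Y). On the vertices of T, the trajectory of M⁻¹ S M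
-- runs down the chain μ_{m₁…m_r}(T), r = |M|, …, 0, then through the quivers obtained from T by
-- reversing all arrows between a prefix of S and its complement (S is a source sequence, and it
-- contains every vertex because it is reddening), and back up the chain, since μ_S(T) = T.
-- As T is abundant acyclic and M is reduced with its first vertex strictly inside S, each mutation
-- along M takes a fork to a fork and strictly increases arrow weights, whereas the reversed-cut
-- quivers keep the weights of T and are pairwise different. This separates all pairs except Y from
-- Y′ and the two quivers reached by one prefix of M before and after S; by injectivity of mutation
-- both come down to Y ≠ Y′. Pick h in I_k with arrows from T into h (A ≠ 0). A mutation at a source s
-- lowers Σ_t b_{t h} by d · outdeg(s) − 2 (d − p), where d = #(h → s) and p = #(s → h). This is
-- positive unless s and h are not adjacent, given three vertices (so outdeg(s) ≥ 4) when M is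
-- nonempty, and d = 0 throughout when M is empty. If every step along S were of the trivial kind,
-- the column of h in Y would vanish, hence also in μ_M(Y) = μ_M(T) →A I_k.

module Submission where

open import Defs

open import Data.Bool using (Bool; true; false; if_then_else_; not; _xor_)
open import Data.Bool.Properties using (∨-zeroʳ; xor-same)
open import Data.Empty using (⊥; ⊥-elim)
open import Data.Fin using (Fin; zero; suc; _↑ˡ_; _↑ʳ_; splitAt; _≟_; punchIn; punchOut)
open import Data.Fin.Properties using (splitAt-↑ˡ; splitAt-↑ʳ; ↑ˡ-injective; punchInᵢ≢i; punchIn-punchOut)
open import Data.Integer using (0ℤ; _⊖_; ∣_∣; +≤+) renaming (_≤_ to _≤ℤ_)
open import Data.Integer.Properties using (∣m⊖n∣≡∣n⊖m∣)
open import Data.List using (List; []; _∷_; _++_; _∷ʳ_; _∷ʳ′_; reverse; map; length; take; drop; initLast)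
open import Data.List.Properties
  using ( ++-identityʳ; ++-assoc; map-++; take-map; reverse-map; length-map; take-all; unfold-reverse
        ; reverse-involutive; reverse-++; length-reverse; length-drop; take++drop≡id)
open import Data.List.Membership.Propositional using (_∈_; _∉_)
open import Data.List.Membership.Propositional.Properties using (∈-++⁺ˡ; ∈-++⁺ʳ; ∈-++⁻)
import Data.List.Membership.DecPropositional as DecMembership
open import Data.List.Relation.Unary.Any using (here; there; index)
open import Data.List.Relation.Unary.Any.Properties using (lookup-index)
open import Data.List.Relation.Unary.All using (All; []; _∷_)
import Data.List.Relation.Unary.All as All
open import Data.List.Relation.Unary.All.Properties using () renaming (++⁺ to All-++⁺)
open import Data.List.Relation.Unary.AllPairs using (AllPairs; []; _∷_) renaming (head to AllPairs-head)
open import Data.List.Relation.Unary.AllPairs.Properties using () renaming (++⁺ to AllPairs-++⁺)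
open import Data.List.Relation.Unary.Linked using (Linked; []; [-]; _∷_)
import Data.List.Relation.Unary.Linked as Linked
open import Data.List.Relation.Unary.Linked.Properties using (Linked⇒AllPairs)
open import Data.Nat using (ℕ; zero; suc; _+_; _*_; _∸_; _<_; _≤_; _<?_; z≤n; s≤s)
open import Data.Nat.Properties hiding (_≟_)
open import Algebra.Properties.Semiring.Sum +-*-semiring using (sum; sum-cong-≗; ∑-distrib-+; *-distribˡ-sum; sum-remove)
open import Data.Nat.Tactic.RingSolver using (solve-∀)
open import Data.Product using (_×_; _,_; proj₁; proj₂; ∃-syntax; Σ-syntax)
open import Data.Sum using (_⊎_; inj₁; inj₂; swap)
import Data.Sum as Sum
open import Data.Unit using (⊤; tt)
open import Relation.Binary.Definitions using (tri<; tri≈; tri>)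
open import Relation.Binary.PropositionalEquality
open import Relation.Nullary using (¬_; Dec; does; yes; no; contradiction)
open import Relation.Nullary.Decidable using (dec-true; dec-false; toSum)

private
  variable
    n : ℕ

≈Q-refl : {P : Arrows n} → P ≈Q P
≈Q-refl x y = refl

≈Q-sym : {P Q : Arrows n} → P ≈Q Q → Q ≈Q P
≈Q-sym P≈Q x y = sym (P≈Q x y)

≈Q-trans : {P Q R : Arrows n} → P ≈Q Q → Q ≈Q R → P ≈Q R
≈Q-trans P≈Q Q≈R x y = trans (P≈Q x y) (Q≈R x y)

≉Q-sym : {P Q : Arrows n} → P ≉Q Q → Q ≉Q P
≉Q-sym P≉Q Q≈P = P≉Q (λ x y → sym (Q≈P x y))

≉Q-resp : {P P′ Q Q′ : Arrows n} → P ≈Q P′ → Q ≈Q Q′ → P ≉Q Q → P′ ≉Q Q′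
≉Q-resp P≈P′ Q≈Q′ P≉Q P′≈Q′ = P≉Q (λ x y → trans (P≈P′ x y) (trans (P′≈Q′ x y) (sym (Q≈Q′ x y))))

I-isQuiver : ∀ k → IsQuiver (I k)
I-isQuiver k = (λ _ → refl) , (λ _ _ → inj₁ refl)

[m∸n+o]∸[n∸m+p]≡[m+o]∸[n+p] : ∀ m n o p → (m ∸ n + o) ∸ (n ∸ m + p) ≡ (m + o) ∸ (n + p)
[m∸n+o]∸[n∸m+p]≡[m+o]∸[n+p] zero    zero    o p = refl
[m∸n+o]∸[n∸m+p]≡[m+o]∸[n+p] zero    (suc n) o p = refl
[m∸n+o]∸[n∸m+p]≡[m+o]∸[n+p] (suc m) zero    o p = refl
[m∸n+o]∸[n∸m+p]≡[m+o]∸[n+p] (suc m) (suc n) o p = [m∸n+o]∸[n∸m+p]≡[m+o]∸[n+p] m n o p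

module _ {Q : Arrows n} (isQ : IsQuiver Q) where

  arrow⇒no-reverse : ∀ {x y} → 0 < Q x y → Q y x ≡ 0
  arrow⇒no-reverse {x} {y} x→y with proj₂ isQ x y
  ... | inj₁ none = contradiction none (m<n⇒n≢0 x→y)
  ... | inj₂ none = none

  arrow⇒≢ : ∀ {x y} → 0 < Q x y → x ≢ y
  arrow⇒≢ {x} x→y refl = contradiction (proj₁ isQ x) (m<n⇒n≢0 x→y)

  no-loop : ∀ {x} → ¬ 0 < Q x x
  no-loop x→x = arrow⇒≢ x→x refl

  no-2-cycle : ∀ {x y} → 0 < Q x y → 0 < Q y x → ⊥
  no-2-cycle x→y y→x = contradiction (arrow⇒no-reverse x→y) (m<n⇒n≢0 y→x)

  ∸-reverse : ∀ x y → Q x y ∸ Q y x ≡ Q x y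
  ∸-reverse x y with proj₂ isQ x y
  ... | inj₁ none rewrite none = 0∸n≡0 (Q y x)
  ... | inj₂ none rewrite none = refl

module _ (k : Fin n) (Q : Arrows n) where

  μ-pivotˡ : ∀ y → μ k Q k y ≡ Q y k
  μ-pivotˡ y rewrite dec-true (k ≟ k) refl = refl

  μ-pivotʳ : ∀ x → μ k Q x k ≡ Q k x
  μ-pivotʳ x rewrite dec-true (k ≟ k) refl | ∨-zeroʳ (does (x ≟ k)) = refl

  μ-away : ∀ {x y} → x ≢ k → y ≢ k →
           μ k Q x y ≡ (Q x y + Q x k * Q k y) ∸ (Q y x + Q y k * Q k x)
  μ-away {x} {y} x≢k y≢k rewrite dec-false (x ≟ k) x≢k | dec-false (y ≟ k) y≢k = refl

μ-without-2-paths : ∀ {k : Fin n} {Q : Arrows n} {x y} → IsQuiver Q → x ≢ k → y ≢ k →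
                    Q x k * Q k y ≡ 0 → Q y k * Q k x ≡ 0 → μ k Q x y ≡ Q x y
μ-without-2-paths {k = k} {Q} {x} {y} isQ x≢k y≢k x⇝y y⇝x = begin
  μ k Q x y                                         ≡⟨ μ-away k Q x≢k y≢k ⟩
  (Q x y + Q x k * Q k y) ∸ (Q y x + Q y k * Q k x)  ≡⟨ cong₂ (λ a b → (Q x y + a) ∸ (Q y x + b)) x⇝y y⇝x ⟩
  (Q x y + 0) ∸ (Q y x + 0)                         ≡⟨ cong₂ _∸_ (+-identityʳ (Q x y)) (+-identityʳ (Q y x)) ⟩
  Q x y ∸ Q y x                                     ≡⟨ ∸-reverse isQ x y ⟩
  Q x y                                             ∎
  where open ≡-Reasoning

-- Case splits on x ≟ k go through toSum, so that the decision inside μ is not abstracted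
-- and μ-pivotˡ, μ-pivotʳ and μ-away still apply.
μ-cong : ∀ (k : Fin n) {P Q : Arrows n} → P ≈Q Q → μ k P ≈Q μ k Q
μ-cong k {P} {Q} P≈Q x y with toSum (x ≟ k) | toSum (y ≟ k)
... | inj₁ refl | _ = trans (μ-pivotˡ k P y) (trans (P≈Q y k) (sym (μ-pivotˡ k Q y)))
... | inj₂ _ | inj₁ refl = trans (μ-pivotʳ k P x) (trans (P≈Q k x) (sym (μ-pivotʳ k Q x)))
... | inj₂ x≢k | inj₂ y≢k = begin
  μ k P x y                                            ≡⟨ μ-away k P x≢k y≢k ⟩
  (P x y + P x k * P k y) ∸ (P y x + P y k * P k x)     ≡⟨ cong₂ _∸_ (same x y) (same y x) ⟩
  (Q x y + Q x k * Q k y) ∸ (Q y x + Q y k * Q k x)     ≡⟨ μ-away k Q x≢k y≢k ⟨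
  μ k Q x y                                            ∎
  where
  open ≡-Reasoning
  same : ∀ u v → P u v + P u k * P k v ≡ Q u v + Q u k * Q k v
  same u v = cong₂ _+_ (P≈Q u v) (cong₂ _*_ (P≈Q u k) (P≈Q k v))

μ-isQuiver : ∀ (k : Fin n) {Q : Arrows n} → IsQuiver Q → IsQuiver (μ k Q)
μ-isQuiver k {Q} (noLoop , no2Cycle) = loopless , no2Cycle′
  where
  loopless : ∀ x → μ k Q x x ≡ 0
  loopless x with toSum (x ≟ k)
  ... | inj₁ refl = trans (μ-pivotˡ k Q k) (noLoop k)
  ... | inj₂ x≢k = trans (μ-away k Q x≢k x≢k) (n∸n≡0 (Q x x + Q x k * Q k x))
  no2Cycle′ : ∀ x y → μ k Q x y ≡ 0 ⊎ μ k Q y x ≡ 0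
  no2Cycle′ x y with toSum (x ≟ k) | toSum (y ≟ k)
  ... | inj₁ refl | _ =
    Sum.map (trans (μ-pivotˡ k Q y)) (trans (μ-pivotʳ k Q y)) (swap (no2Cycle k y))
  ... | inj₂ _ | inj₁ refl =
    Sum.map (trans (μ-pivotʳ k Q x)) (trans (μ-pivotˡ k Q x)) (swap (no2Cycle x k))
  ... | inj₂ x≢k | inj₂ y≢k =
    Sum.map (trans (μ-away k Q x≢k y≢k)) (trans (μ-away k Q y≢k x≢k))
                 (∸-or-∸≡0 (Q x y + Q x k * Q k y) (Q y x + Q y k * Q k x))
    where
    ∸-or-∸≡0 : ∀ a b → a ∸ b ≡ 0 ⊎ b ∸ a ≡ 0
    ∸-or-∸≡0 a b with ≤-total a b
    ... | inj₁ a≤b = inj₁ (m≤n⇒m∸n≡0 a≤b)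
    ... | inj₂ b≤a = inj₂ (m≤n⇒m∸n≡0 b≤a)

μ-involutive : ∀ (k : Fin n) {Q : Arrows n} → IsQuiver Q → μ k (μ k Q) ≈Q Q
μ-involutive k {Q} isQ x y with toSum (x ≟ k) | toSum (y ≟ k)
... | inj₁ refl | _ = trans (μ-pivotˡ k (μ k Q) y) (μ-pivotʳ k Q y)
... | inj₂ _ | inj₁ refl = trans (μ-pivotʳ k (μ k Q) x) (μ-pivotˡ k Q x)
... | inj₂ x≢k | inj₂ y≢k = begin
  μ k Q′ x y
    ≡⟨ μ-away k Q′ x≢k y≢k ⟩
  (Q′ x y + Q′ x k * Q′ k y) ∸ (Q′ y x + Q′ y k * Q′ k x)
    ≡⟨ cong₂ _∸_ (cong₂ _+_ (μ-away k Q x≢k y≢k) (cong₂ _*_ (μ-pivotʳ k Q x) (μ-pivotˡ k Q y)))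
                 (cong₂ _+_ (μ-away k Q y≢k x≢k) (cong₂ _*_ (μ-pivotʳ k Q y) (μ-pivotˡ k Q x))) ⟩
  ((Q x y + p) ∸ (Q y x + q) + Q k x * Q y k) ∸ ((Q y x + q) ∸ (Q x y + p) + Q k y * Q x k)
    ≡⟨ [m∸n+o]∸[n∸m+p]≡[m+o]∸[n+p] (Q x y + p) (Q y x + q) _ _ ⟩
  (Q x y + p + Q k x * Q y k) ∸ (Q y x + q + Q k y * Q x k)
    ≡⟨ cong₂ (λ a b → (Q x y + p + a) ∸ (Q y x + q + b)) (*-comm (Q k x) (Q y k)) (*-comm (Q k y) (Q x k)) ⟩
  (Q x y + p + q) ∸ (Q y x + q + p)
    ≡⟨ cong₂ _∸_ (+-assoc (Q x y) p q) (trans (+-assoc (Q y x) q p) (cong (Q y x +_) (+-comm q p))) ⟩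
  (Q x y + (p + q)) ∸ (Q y x + (p + q))
    ≡⟨ cong₂ _∸_ (+-comm (Q x y) (p + q)) (+-comm (Q y x) (p + q)) ⟩
  (p + q + Q x y) ∸ (p + q + Q y x)
    ≡⟨ [m+n]∸[m+o]≡n∸o (p + q) (Q x y) (Q y x) ⟩
  Q x y ∸ Q y x
    ≡⟨ ∸-reverse isQ x y ⟩
  Q x y ∎
  where
  open ≡-Reasoning
  Q′ = μ k Q
  p = Q x k * Q k y
  q = Q y k * Q k x

μ-injective : ∀ (k : Fin n) {P Q : Arrows n} → IsQuiver P → IsQuiver Q → μ k P ≈Q μ k Q → P ≈Q Q
μ-injective k isP isQ μP≈μQ =
  ≈Q-trans (≈Q-sym (μ-involutive k isP)) (≈Q-trans (μ-cong k μP≈μQ) (μ-involutive k isQ))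

μs-++ : ∀ (L L′ : List (Fin n)) Q → μs (L ++ L′) Q ≡ μs L′ (μs L Q)
μs-++ []      L′ Q = refl
μs-++ (i ∷ L) L′ Q = μs-++ L L′ (μ i Q)

μs-cong : ∀ (L : List (Fin n)) {P Q : Arrows n} → P ≈Q Q → μs L P ≈Q μs L Q
μs-cong []      P≈Q = P≈Q
μs-cong (i ∷ L) P≈Q = μs-cong L (μ-cong i P≈Q)

μs-isQuiver : ∀ (L : List (Fin n)) {Q : Arrows n} → IsQuiver Q → IsQuiver (μs L Q)
μs-isQuiver []      isQ = isQ
μs-isQuiver (i ∷ L) isQ = μs-isQuiver L (μ-isQuiver i isQ)

μs-reverse∘μs : ∀ (L : List (Fin n)) {Q : Arrows n} → IsQuiver Q → μs (reverse L) (μs L Q) ≈Q Q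
μs-reverse∘μs []      isQ = ≈Q-refl
μs-reverse∘μs (i ∷ L) {Q} isQ
  rewrite unfold-reverse i L | μs-++ (reverse L) (i ∷ []) (μs L (μ i Q)) =
  ≈Q-trans (μ-cong i (μs-reverse∘μs L (μ-isQuiver i isQ))) (μ-involutive i isQ)

μs∘μs-reverse : ∀ (L : List (Fin n)) {Q : Arrows n} → IsQuiver Q → μs L (μs (reverse L) Q) ≈Q Q
μs∘μs-reverse L {Q} isQ =
  subst (λ L′ → μs L′ (μs (reverse L) Q) ≈Q Q) (reverse-involutive L) (μs-reverse∘μs (reverse L) isQ)

μs-injective : ∀ (L : List (Fin n)) {P Q : Arrows n} → IsQuiver P → IsQuiver Q → μs L P ≈Q μs L Q → P ≈Q Q
μs-injective []      isP isQ eq = eq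
μs-injective (i ∷ L) isP isQ eq =
  μ-injective i isP isQ (μs-injective L (μ-isQuiver i isP) (μ-isQuiver i isQ) eq)

weight : Arrows n → Fin n → Fin n → ℕ
weight Q x y = Q x y + Q y x

Abundantʷ : Arrows n → Set
Abundantʷ {n} Q = ∀ (x y : Fin n) → x ≢ y → 2 ≤ weight Q x y

Abundant⇒Abundantʷ : ∀ {Q : Arrows n} → IsQuiver Q → Abundant Q → Abundantʷ Q
Abundant⇒Abundantʷ {Q = Q} isQ abQ x y x≢y = subst (2 ≤_) (∣b∣≡weight (proj₂ isQ x y)) (abQ x y x≢y)
  where
  ∣b∣≡weight : Q x y ≡ 0 ⊎ Q y x ≡ 0 → ∣ b Q x y ∣ ≡ weight Q x y
  ∣b∣≡weight (inj₁ none) rewrite none = ∣m⊖n∣≡∣n⊖m∣ 0 (Q y x)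
  ∣b∣≡weight (inj₂ none) rewrite none = sym (+-identityʳ (Q x y))

infix 4 _⊏_

record _⊏_ (P Q : Arrows n) : Set where
  constructor mk⊏
  field
    weight-≤ : ∀ x y → weight P x y ≤ weight Q x y
    weight-< : ∃[ x ] ∃[ y ] weight P x y < weight Q x y

⊏-trans : {P Q R : Arrows n} → P ⊏ Q → Q ⊏ R → P ⊏ R
⊏-trans (mk⊏ P≤Q (x , y , P<Q)) (mk⊏ Q≤R _) =
  mk⊏ (λ u v → ≤-trans (P≤Q u v) (Q≤R u v)) (x , y , <-≤-trans P<Q (Q≤R x y))

⊏⇒≉ : {P Q : Arrows n} → P ⊏ Q → P ≉Q Q
⊏⇒≉ (mk⊏ _ (x , y , P<Q)) P≈Q = <-irrefl (cong₂ _+_ (P≈Q x y) (P≈Q y x)) P<Q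

⊏-respˡ-weight : {P P′ Q : Arrows n} → (∀ x y → weight P x y ≡ weight P′ x y) → P ⊏ Q → P′ ⊏ Q
⊏-respˡ-weight {Q = Q} w≡ (mk⊏ P≤Q (x , y , P<Q)) =
  mk⊏ (λ u v → subst (_≤ weight Q u v) (w≡ u v) (P≤Q u v)) (x , y , subst (_< weight Q x y) (w≡ x y) P<Q)

module _ {Q : Arrows n} (isQ : IsQuiver Q) (abQ : Abundantʷ Q) where

  arrow⇒2≤ : ∀ {x y} → 0 < Q x y → 2 ≤ Q x y
  arrow⇒2≤ {x} {y} x→y =
    subst (2 ≤_) (trans (cong (Q x y +_) (arrow⇒no-reverse isQ x→y)) (+-identityʳ (Q x y)))
          (abQ x y (arrow⇒≢ isQ x→y))

  no-reverse⇒arrow : ∀ {x y} → x ≢ y → Q y x ≡ 0 → 0 < Q x y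
  no-reverse⇒arrow {x} {y} x≢y none =
    <-≤-trans (s≤s z≤n) (subst (2 ≤_) (trans (cong (Q x y +_) none) (+-identityʳ (Q x y))) (abQ x y x≢y))

  in-or-out : ∀ {x k} → x ≢ k → 0 < Q x k ⊎ 0 < Q k x
  in-or-out {x} {k} x≢k with proj₂ isQ x k
  ... | inj₁ none = inj₂ (no-reverse⇒arrow (≢-sym x≢k) none)
  ... | inj₂ none = inj₁ (no-reverse⇒arrow x≢k none)

TransitiveOn : Arrows n → (Fin n → Set) → Set
TransitiveOn {n} Q P =
  ∀ {x y z : Fin n} → P x → P y → P z → 0 < Q x y → 0 < Q y z → 0 < Q x z

-- The conditions on F under which mutating at k produces a fork with point of return k.
record PreFork (F : Arrows n) (k : Fin n) : Set where
  field
    isQuiver       : IsQuiver F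
    abundant       : Abundantʷ F
    composite      : ∀ x y → 0 < F x k → 0 < F k y → 0 < F x y ⊎ F y x < F x k ⊎ F y x < F k y
    in-transitive  : TransitiveOn F (λ x → 0 < F x k)
    out-transitive : TransitiveOn F (λ y → 0 < F k y)
    has-in         : ∃[ x ] 0 < F x k
    has-out        : ∃[ y ] 0 < F k y

-- A fork with point of return r (Warkentin); acyclicity of the in- and out-neighbourhoods of r is
-- expressed as transitivity, which is equivalent for abundant quivers.
record Fork (F : Arrows n) (r : Fin n) : Set where
  field
    isQuiver       : IsQuiver F
    abundant       : Abundantʷ F
    in-transitive  : TransitiveOn F (λ x → 0 < F x r)
    out-transitive : TransitiveOn F (λ y → 0 < F r y)
    return-heavy   : ∀ i j → 0 < F i r → 0 < F r j → F i r < F j i × F r j < F j i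
    has-in         : ∃[ i ] 0 < F i r
    has-out        : ∃[ j ] 0 < F r j

m+m≤n*m : ∀ m {n} → 2 ≤ n → m + m ≤ n * m
m+m≤n*m m {n} 2≤n = subst (_≤ n * m) (cong (m +_) (+-identityʳ m)) (*-monoˡ-≤ m 2≤n)

m+n≤m*n : ∀ {m n} → 2 ≤ m → 2 ≤ n → m + n ≤ m * n
m+n≤m*n {m} {n} 2≤m 2≤n with ≤-total m n
... | inj₁ m≤n = ≤-trans (+-monoˡ-≤ n m≤n) (m+m≤n*m n 2≤m)
... | inj₂ n≤m = ≤-trans (+-monoʳ-≤ m n≤m) (subst (m + m ≤_) (*-comm n m) (m+m≤n*m m 2≤n))

-- Mutating along x → k → y with a = #(x→k) ≥ 2, c = #(k→y) ≥ 2, v = #(x→y), u = #(y→x)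
-- leaves (v + a * c) ∸ u arrows x → y; these bounds make it exceed a, c and v + u.
composite-lower-bounds :
  ∀ {a c u v} → 2 ≤ a → 2 ≤ c → u ≡ 0 ⊎ v ≡ 0 → 0 < v ⊎ u < a ⊎ u < c →
  c + u < v + a * c × a + u < v + a * c × v + u + u < v + a * c
composite-lower-bounds {a} {c} {v = v} 2≤a 2≤c (inj₁ refl) _ =
  subst (_< v + a * c) (sym (+-identityʳ c)) (<-≤-trans (m<m+n c 0<c) (≤-trans c+c≤ac (m≤n+m (a * c) v))) ,
  subst (_< v + a * c) (sym (+-identityʳ a)) (<-≤-trans (m<m+n a 0<a) (≤-trans a+a≤ac (m≤n+m (a * c) v))) ,
  subst (_< v + a * c) (sym (trans (+-identityʳ (v + 0)) (+-identityʳ v))) (m<m+n v (*-mono-< 0<a 0<c))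
  where
  0<a = <-≤-trans (s≤s z≤n) 2≤a
  0<c = <-≤-trans (s≤s z≤n) 2≤c
  c+c≤ac = m+m≤n*m c 2≤a
  a+a≤ac = subst (a + a ≤_) (*-comm c a) (m+m≤n*m a 2≤c)
composite-lower-bounds 2≤a 2≤c (inj₂ refl) (inj₁ ())
composite-lower-bounds {a} {c} 2≤a 2≤c (inj₂ refl) (inj₂ (inj₁ u<a)) =
  <-≤-trans (+-monoʳ-< c u<a) (subst (_≤ a * c) (+-comm a c) (m+n≤m*n 2≤a 2≤c)) ,
  <-≤-trans (+-monoʳ-< a u<a) a+a≤ac ,
  <-≤-trans (+-mono-< u<a u<a) a+a≤ac
  where
  a+a≤ac = subst (a + a ≤_) (*-comm c a) (m+m≤n*m a 2≤c)
composite-lower-bounds {a} {c} 2≤a 2≤c (inj₂ refl) (inj₂ (inj₂ u<c)) =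
  <-≤-trans (+-monoʳ-< c u<c) (m+m≤n*m c 2≤a) ,
  <-≤-trans (+-monoʳ-< a u<c) (m+n≤m*n 2≤a 2≤c) ,
  <-≤-trans (+-mono-< u<c u<c) (m+m≤n*m c 2≤a)

module PreForkMutation {F : Arrows n} {k : Fin n} (pf : PreFork F k) where

  open PreFork pf

  μ-among-in : ∀ {x y} → 0 < F x k → 0 < F y k → μ k F x y ≡ F x y
  μ-among-in {x} {y} x→k y→k =
    μ-without-2-paths isQuiver (arrow⇒≢ isQuiver x→k) (arrow⇒≢ isQuiver y→k)
      (trans (cong (F x k *_) (arrow⇒no-reverse isQuiver y→k)) (*-zeroʳ (F x k)))
      (trans (cong (F y k *_) (arrow⇒no-reverse isQuiver x→k)) (*-zeroʳ (F y k)))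

  μ-among-out : ∀ {x y} → 0 < F k x → 0 < F k y → μ k F x y ≡ F x y
  μ-among-out {x} {y} k→x k→y =
    μ-without-2-paths isQuiver (≢-sym (arrow⇒≢ isQuiver k→x)) (≢-sym (arrow⇒≢ isQuiver k→y))
      (cong (_* F k y) (arrow⇒no-reverse isQuiver k→x))
      (cong (_* F k x) (arrow⇒no-reverse isQuiver k→y))

  μ-composite : ∀ {x y} → 0 < F x k → 0 < F k y →
                μ k F y x ≡ 0 × F k y < μ k F x y × F x k < μ k F x y × weight F x y < μ k F x y
  μ-composite {x} {y} x→k k→y =
    old ,
    subst (F k y <_) (sym new) (m+n≤o⇒m≤o∸n (suc (F k y)) c+u<N) ,
    subst (F x k <_) (sym new) (m+n≤o⇒m≤o∸n (suc (F x k)) a+u<N) ,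
    subst (weight F x y <_) (sym new) (m+n≤o⇒m≤o∸n (suc (weight F x y)) v+u+u<N)
    where
    x≢k = arrow⇒≢ isQuiver x→k
    y≢k = ≢-sym (arrow⇒≢ isQuiver k→y)
    no-y⇝x : F y k * F k x ≡ 0
    no-y⇝x = cong (_* F k x) (arrow⇒no-reverse isQuiver k→y)
    bounds = composite-lower-bounds (arrow⇒2≤ isQuiver abundant x→k) (arrow⇒2≤ isQuiver abundant k→y)
               (swap (proj₂ isQuiver x y)) (composite x y x→k k→y)
    c+u<N = proj₁ bounds
    a+u<N = proj₁ (proj₂ bounds)
    v+u+u<N = proj₂ (proj₂ bounds)
    new : μ k F x y ≡ (F x y + F x k * F k y) ∸ F y x
    new = trans (μ-away k F x≢k y≢k) (cong ((F x y + F x k * F k y) ∸_) (trans (cong (F y x +_) no-y⇝x) (+-identityʳ (F y x))))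
    old : μ k F y x ≡ 0
    old = trans (μ-away k F y≢k x≢k)
                (trans (cong (_∸ (F x y + F x k * F k y)) (trans (cong (F y x +_) no-y⇝x) (+-identityʳ (F y x))))
                       (m≤n⇒m∸n≡0 (<⇒≤ (≤-<-trans (m≤n+m (F y x) (F k y)) c+u<N))))

  μ-weight-≤ : ∀ x y → weight F x y ≤ weight (μ k F) x y
  μ-weight-≤ x y with toSum (x ≟ k) | toSum (y ≟ k)
  ... | inj₁ refl | _ = ≤-reflexive (trans (+-comm (F k y) (F y k)) (sym (cong₂ _+_ (μ-pivotˡ k F y) (μ-pivotʳ k F y))))
  ... | inj₂ _ | inj₁ refl = ≤-reflexive (trans (+-comm (F x k) (F k x)) (sym (cong₂ _+_ (μ-pivotʳ k F x) (μ-pivotˡ k F x))))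
  ... | inj₂ x≢k | inj₂ y≢k with in-or-out isQuiver abundant x≢k | in-or-out isQuiver abundant y≢k
  ...   | inj₁ x→k | inj₁ y→k = ≤-reflexive (sym (cong₂ _+_ (μ-among-in x→k y→k) (μ-among-in y→k x→k)))
  ...   | inj₂ k→x | inj₂ k→y = ≤-reflexive (sym (cong₂ _+_ (μ-among-out k→x k→y) (μ-among-out k→y k→x)))
  ...   | inj₁ x→k | inj₂ k→y =
    let (none , _ , _ , grows) = μ-composite x→k k→y
    in  ≤-trans (<⇒≤ grows) (≤-reflexive (sym (trans (cong (μ k F x y +_) none) (+-identityʳ _))))
  ...   | inj₂ k→x | inj₁ y→k =
    let (none , _ , _ , grows) = μ-composite y→k k→x
    in  subst₂ _≤_ (+-comm (F y x) (F x y)) (cong (_+ μ k F y x) (sym none)) (<⇒≤ grows)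

  μ-⊏ : F ⊏ μ k F
  μ-⊏ with has-in | has-out
  ... | x , x→k | y , k→y =
    mk⊏ μ-weight-≤ (x , y , <-≤-trans (proj₂ (proj₂ (proj₂ (μ-composite x→k k→y)))) (m≤m+n (μ k F x y) _))

  μ-Fork : Fork (μ k F) k
  μ-Fork = record
    { isQuiver       = μ-isQuiver k isQuiver
    ; abundant       = λ x y x≢y → ≤-trans (abundant x y x≢y) (μ-weight-≤ x y)
    ; in-transitive  = λ x→k y→k z→k x→y y→z →
        let k→x = from-in x→k ; k→y = from-in y→k ; k→z = from-in z→k
        in  subst (0 <_) (sym (μ-among-out k→x k→z))
              (out-transitive k→x k→y k→z (subst (0 <_) (μ-among-out k→x k→y) x→y)
                                          (subst (0 <_) (μ-among-out k→y k→z) y→z))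
    ; out-transitive = λ k→x k→y k→z x→y y→z →
        let x→k = from-out k→x ; y→k = from-out k→y ; z→k = from-out k→z
        in  subst (0 <_) (sym (μ-among-in x→k z→k))
              (in-transitive x→k y→k z→k (subst (0 <_) (μ-among-in x→k y→k) x→y)
                                         (subst (0 <_) (μ-among-in y→k z→k) y→z))
    ; return-heavy   = λ i j i→k k→j →
        let (_ , k→i<ji , j→k<ji , _) = μ-composite (from-out k→j) (from-in i→k)
        in  subst (_< μ k F j i) (sym (μ-pivotʳ k F i)) k→i<ji ,
            subst (_< μ k F j i) (sym (μ-pivotˡ k F j)) j→k<ji
    ; has-in         = let (y , k→y) = has-out in y , subst (0 <_) (sym (μ-pivotʳ k F y)) k→y
    ; has-out        = let (x , x→k) = has-in in x , subst (0 <_) (sym (μ-pivotˡ k F x)) x→k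
    }
    where
    from-in : ∀ {x} → 0 < μ k F x k → 0 < F k x
    from-in {x} = subst (0 <_) (μ-pivotʳ k F x)
    from-out : ∀ {y} → 0 < μ k F k y → 0 < F y k
    from-out {y} = subst (0 <_) (μ-pivotˡ k F y)

module ForkProperties {F : Arrows n} {r : Fin n} (fk : Fork F r) where

  open Fork fk

  side : ∀ {x} → x ≢ r → 0 < F x r ⊎ 0 < F r x
  side = in-or-out isQuiver abundant

  out→in : ∀ {i j} → 0 < F i r → 0 < F r j → 0 < F j i
  out→in {i} {j} i→r r→j = ≤-<-trans z≤n (proj₁ (return-heavy i j i→r r→j))

  transitive-off-return : ∀ {x y z} → x ≢ r → y ≢ r → z ≢ r → 0 < F x y → 0 < F y z → 0 < F x z
  transitive-off-return x≢r y≢r z≢r x→y y→z with side x≢r | side y≢r | side z≢r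
  ... | inj₁ x→r | inj₂ r→y | _         = ⊥-elim (no-2-cycle isQuiver x→y (out→in x→r r→y))
  ... | inj₁ _   | inj₁ y→r | inj₂ r→z  = ⊥-elim (no-2-cycle isQuiver y→z (out→in y→r r→z))
  ... | inj₁ x→r | inj₁ y→r | inj₁ z→r  = in-transitive x→r y→r z→r x→y y→z
  ... | inj₂ r→x | _        | inj₁ z→r  = out→in z→r r→x
  ... | inj₂ _   | inj₁ y→r | inj₂ r→z  = ⊥-elim (no-2-cycle isQuiver y→z (out→in y→r r→z))
  ... | inj₂ r→x | inj₂ r→y | inj₂ r→z  = out-transitive r→x r→y r→z x→y y→z

  PreFork-at-out : ∀ {k} → 0 < F r k → PreFork F k
  PreFork-at-out {k} r→k = record
    { isQuiver       = isQuiver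
    ; abundant       = abundant
    ; composite      = composite
    ; in-transitive  = in-transitive′
    ; out-transitive = λ k→x k→y k→z → transitive-off-return (≢r k→x) (≢r k→y) (≢r k→z)
    ; has-in         = r , r→k
    ; has-out        = let (i , i→r) = has-in in i , out→in i→r r→k
    }
    where
    ≢r : ∀ {y} → 0 < F k y → y ≢ r
    ≢r k→y refl = no-2-cycle isQuiver r→k k→y
    return-or-out : ∀ {x} → 0 < F x k → x ≡ r ⊎ 0 < F r x
    return-or-out {x} x→k with toSum (x ≟ r)
    ... | inj₁ x≡r = inj₁ x≡r
    ... | inj₂ x≢r with side x≢r
    ...   | inj₁ x→r = ⊥-elim (no-2-cycle isQuiver x→k (out→in x→r r→k))
    ...   | inj₂ r→x = inj₂ r→x
    composite : ∀ x y → 0 < F x k → 0 < F k y → 0 < F x y ⊎ F y x < F x k ⊎ F y x < F k y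
    composite x y x→k k→y with return-or-out x→k | side (≢r k→y)
    ... | inj₁ refl | inj₂ r→y = inj₁ r→y
    ... | inj₁ refl | inj₁ y→r = inj₂ (inj₂ (proj₁ (return-heavy y k y→r r→k)))
    ... | inj₂ r→x  | inj₂ r→y = inj₁ (out-transitive r→x r→k r→y x→k k→y)
    ... | inj₂ r→x  | inj₁ y→r = inj₁ (out→in y→r r→x)
    in-transitive′ : TransitiveOn F (λ x → 0 < F x k)
    in-transitive′ x→k y→k z→k x→y y→z with return-or-out x→k | return-or-out y→k | return-or-out z→k
    ... | inj₁ refl | inj₁ refl | _         = ⊥-elim (no-loop isQuiver x→y)
    ... | inj₁ refl | inj₂ r→y  | inj₁ refl = ⊥-elim (no-2-cycle isQuiver r→y y→z)
    ... | inj₁ refl | _         | inj₂ r→z  = r→z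
    ... | inj₂ r→x  | inj₁ refl | _         = ⊥-elim (no-2-cycle isQuiver r→x x→y)
    ... | inj₂ _    | inj₂ r→y  | inj₁ refl = ⊥-elim (no-2-cycle isQuiver r→y y→z)
    ... | inj₂ r→x  | inj₂ r→y  | inj₂ r→z  = out-transitive r→x r→y r→z x→y y→z

  PreFork-at-in : ∀ {k} → 0 < F k r → PreFork F k
  PreFork-at-in {k} k→r = record
    { isQuiver       = isQuiver
    ; abundant       = abundant
    ; composite      = composite
    ; in-transitive  = λ x→k y→k z→k → transitive-off-return (≢r x→k) (≢r y→k) (≢r z→k)
    ; out-transitive = out-transitive′
    ; has-in         = let (j , r→j) = has-out in j , out→in k→r r→j
    ; has-out        = r , k→r
    }
    where
    ≢r : ∀ {x} → 0 < F x k → x ≢ r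
    ≢r x→k refl = no-2-cycle isQuiver k→r x→k
    return-or-in : ∀ {y} → 0 < F k y → y ≡ r ⊎ 0 < F y r
    return-or-in {y} k→y with toSum (y ≟ r)
    ... | inj₁ y≡r = inj₁ y≡r
    ... | inj₂ y≢r with side y≢r
    ...   | inj₁ y→r = inj₂ y→r
    ...   | inj₂ r→y = ⊥-elim (no-2-cycle isQuiver k→y (out→in k→r r→y))
    composite : ∀ x y → 0 < F x k → 0 < F k y → 0 < F x y ⊎ F y x < F x k ⊎ F y x < F k y
    composite x y x→k k→y with return-or-in k→y | side (≢r x→k)
    ... | inj₁ refl | inj₁ x→r = inj₁ x→r
    ... | inj₁ refl | inj₂ r→x = inj₂ (inj₁ (proj₂ (return-heavy k x k→r r→x)))
    ... | inj₂ y→r  | inj₁ x→r = inj₁ (in-transitive x→r k→r y→r x→k k→y)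
    ... | inj₂ y→r  | inj₂ r→x = inj₁ (out→in y→r r→x)
    out-transitive′ : TransitiveOn F (λ y → 0 < F k y)
    out-transitive′ k→x k→y k→z x→y y→z with return-or-in k→x | return-or-in k→y | return-or-in k→z
    ... | inj₁ refl | inj₁ refl | _         = ⊥-elim (no-loop isQuiver x→y)
    ... | inj₁ refl | inj₂ y→r  | _         = ⊥-elim (no-2-cycle isQuiver x→y y→r)
    ... | inj₂ x→r  | _         | inj₁ refl = x→r
    ... | inj₂ _    | inj₁ refl | inj₂ z→r  = ⊥-elim (no-2-cycle isQuiver y→z z→r)
    ... | inj₂ x→r  | inj₂ y→r  | inj₂ z→r  = in-transitive x→r y→r z→r x→y y→z

  PreFork-away-from-return : ∀ {k} → k ≢ r → PreFork F k
  PreFork-away-from-return k≢r with side k≢r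
  ... | inj₁ k→r = PreFork-at-in k→r
  ... | inj₂ r→k = PreFork-at-out r→k

Linked-traj-∷ : ∀ {R : Arrows n → Arrows n → Set} (L : List (Fin n)) {X Y} →
                R X Y → Linked R (traj L Y) → Linked R (X ∷ traj L Y)
Linked-traj-∷ []      RXY _ = RXY ∷ [-]
Linked-traj-∷ (_ ∷ _) RXY l = RXY ∷ l

Fork-traj-⊏ : ∀ {F : Arrows n} {r} (L : List (Fin n)) → Fork F r → Linked _≢_ (r ∷ L) → Linked _⊏_ (traj L F)
Fork-traj-⊏ []      _  _           = [-]
Fork-traj-⊏ (k ∷ L) fk (r≢k ∷ rkL) =
  Linked-traj-∷ L (PreForkMutation.μ-⊏ pf) (Fork-traj-⊏ L (PreForkMutation.μ-Fork pf) rkL)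
  where pf = ForkProperties.PreFork-away-from-return fk (≢-sym r≢k)

PreFork-traj-⊏ : ∀ {F : Arrows n} {k} (L : List (Fin n)) → PreFork F k → Linked _≢_ (k ∷ L) →
                 AllPairs _⊏_ (traj (k ∷ L) F)
PreFork-traj-⊏ L pf kL =
  Linked⇒AllPairs ⊏-trans (Linked-traj-∷ L (PreForkMutation.μ-⊏ pf) (Fork-traj-⊏ L (PreForkMutation.μ-Fork pf) kL))

abundant-acyclic⇒transitive : ∀ {T : Arrows n} → IsQuiver T → Abundantʷ T → Acyclic T →
                              ∀ {x y z} → 0 < T x y → 0 < T y z → 0 < T x z
abundant-acyclic⇒transitive isT abT acT {x} {y} {z} x→y y→z with toSum (x ≟ z)
... | inj₁ refl = ⊥-elim (acT x (cons x→y (edge y→z)))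
... | inj₂ x≢z with in-or-out isT abT x≢z
...   | inj₁ x→z = x→z
...   | inj₂ z→x = ⊥-elim (acT x (cons x→y (cons y→z (edge z→x))))

abundant-acyclic⇒PreFork : ∀ {T : Arrows n} {k} → IsQuiver T → Abundantʷ T → Acyclic T →
                           ∃[ x ] 0 < T x k → ∃[ y ] 0 < T k y → PreFork T k
abundant-acyclic⇒PreFork isT abT acT has-in has-out = record
  { isQuiver       = isT
  ; abundant       = abT
  ; composite      = λ _ _ x→k k→y → inj₁ (trans′ x→k k→y)
  ; in-transitive  = λ _ _ _ → trans′
  ; out-transitive = λ _ _ _ → trans′
  ; has-in         = has-in
  ; has-out        = has-out
  }
  where trans′ = abundant-acyclic⇒transitive isT abT acT

traj⁺ : List (Fin n) → Arrows n → List (Arrows n)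
traj⁺ []      X = []
traj⁺ (i ∷ L) X = traj L (μ i X)

traj≡∷traj⁺ : ∀ (L : List (Fin n)) X → traj L X ≡ X ∷ traj⁺ L X
traj≡∷traj⁺ []      X = refl
traj≡∷traj⁺ (i ∷ L) X = refl

traj-++ : ∀ (L L′ : List (Fin n)) X → traj (L ++ L′) X ≡ traj L X ++ traj⁺ L′ (μs L X)
traj-++ []      L′ X = traj≡∷traj⁺ L′ X
traj-++ (i ∷ L) L′ X = cong (X ∷_) (traj-++ L L′ (μ i X))

traj⁺-++ : ∀ (L L′ : List (Fin n)) X → traj⁺ (L ++ L′) X ≡ traj⁺ L X ++ traj⁺ L′ (μs L X)
traj⁺-++ []      L′ X = refl
traj⁺-++ (i ∷ L) L′ X = traj-++ L L′ (μ i X)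

module _ {P : Arrows n → Set} where

  traj-All : ∀ L X → (∀ q → q ≤ length L → P (μs (take q L) X)) → All P (traj L X)
  traj-All []      X p = p 0 z≤n ∷ []
  traj-All (i ∷ L) X p = p 0 z≤n ∷ traj-All L (μ i X) (λ q q≤ → p (suc q) (s≤s q≤))

  traj⁺-All : ∀ L X → (∀ q → q < length L → P (μs (take (suc q) L) X)) → All P (traj⁺ L X)
  traj⁺-All []      X p = []
  traj⁺-All (i ∷ L) X p = traj-All L (μ i X) (λ q q≤ → p q (s≤s q≤))

  All-traj⁻ : ∀ L X → All P (traj L X) → ∀ q → q ≤ length L → P (μs (take q L) X)
  All-traj⁻ []      X (p ∷ _)  zero    _       = p
  All-traj⁻ (i ∷ L) X (p ∷ _)  zero    _       = p
  All-traj⁻ (i ∷ L) X (_ ∷ ps) (suc q) (s≤s q≤) = All-traj⁻ L (μ i X) ps q q≤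

module _ {R : Arrows n → Arrows n → Set} where

  traj-AllPairs : ∀ L X → (∀ q q′ → q < q′ → q′ ≤ length L → R (μs (take q L) X) (μs (take q′ L) X)) →
                  AllPairs R (traj L X)
  traj-AllPairs []      X r = [] ∷ []
  traj-AllPairs (i ∷ L) X r =
    traj-All L (μ i X) (λ q q≤ → r 0 (suc q) (s≤s z≤n) (s≤s q≤)) ∷
    traj-AllPairs L (μ i X) (λ q q′ q<q′ q′≤ → r (suc q) (suc q′) (s≤s q<q′) (s≤s q′≤))

  traj⁺-AllPairs : ∀ L X → (∀ q q′ → q < q′ → q′ < length L → R (μs (take (suc q) L) X) (μs (take (suc q′) L) X)) →
                   AllPairs R (traj⁺ L X)
  traj⁺-AllPairs []      X r = []
  traj⁺-AllPairs (i ∷ L) X r = traj-AllPairs L (μ i X) (λ q q′ q<q′ q′≤ → r q q′ q<q′ (s≤s q′≤))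

  AllPairs-traj⁻ : ∀ L X → AllPairs R (traj L X) →
                   ∀ q q′ → q < q′ → q′ ≤ length L → R (μs (take q L) X) (μs (take q′ L) X)
  AllPairs-traj⁻ (i ∷ L) X (r ∷ _)  zero    (suc q′) _         (s≤s q′≤) = All-traj⁻ L (μ i X) r q′ q′≤
  AllPairs-traj⁻ (i ∷ L) X (_ ∷ rs) (suc q) (suc q′) (s≤s q<q′) (s≤s q′≤) = AllPairs-traj⁻ L (μ i X) rs q q′ q<q′ q′≤

take-length-++ : ∀ {A : Set} (xs ys : List A) → take (length xs) (xs ++ ys) ≡ xs
take-length-++ []       ys = refl
take-length-++ (x ∷ xs) ys = cong (x ∷_) (take-length-++ xs ys)

μs-take-reverse : ∀ (L : List (Fin n)) {X} → IsQuiver X → ∀ q → q ≤ length L →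
                  μs (take q (reverse L)) X ≈Q μs (take (length L ∸ q) L) (μs (reverse L) X)
μs-take-reverse L {X} isX q q≤ =
  subst₂ (λ A B → A ≈Q μs K B) (sym start) (sym (cong (λ L′ → μs L′ X) split))
    (subst (λ B → μs (reverse D) X ≈Q μs K B) (sym (μs-++ (reverse D) (reverse K) X))
      (≈Q-sym (μs∘μs-reverse K (μs-isQuiver (reverse D) isX))))
  where
  K = take (length L ∸ q) L
  D = drop (length L ∸ q) L
  split : reverse L ≡ reverse D ++ reverse K
  split = trans (cong reverse (sym (take++drop≡id (length L ∸ q) L))) (reverse-++ K D)
  |D|≡q : length (reverse D) ≡ q
  |D|≡q = trans (length-reverse D) (trans (length-drop (length L ∸ q) L) (m∸[m∸n]≡n q≤))
  start : μs (take q (reverse L)) X ≡ μs (reverse D) X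
  start = cong (λ L′ → μs L′ X)
            (trans (cong₂ take (sym |D|≡q) split) (take-length-++ (reverse D) (reverse K)))

module _ {P : Arrows n → Set} (P-resp : ∀ {X Z} → X ≈Q Z → P X → P Z) where

  traj-reverse-All : ∀ L {X} → IsQuiver X →
                     (∀ p → p ≤ length L → P (μs (take p L) (μs (reverse L) X))) → All P (traj (reverse L) X)
  traj-reverse-All L {X} isX p =
    traj-All (reverse L) X λ q q≤ →
      let q≤L = subst (q ≤_) (length-reverse L) q≤
      in  P-resp (≈Q-sym (μs-take-reverse L isX q q≤L)) (p (length L ∸ q) (m∸n≤m (length L) q))

module _ {R : Arrows n → Arrows n → Set}
         (R-resp : ∀ {X X′ Z Z′} → X ≈Q X′ → Z ≈Q Z′ → R X Z → R X′ Z′) where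

  traj-reverse-AllPairs : ∀ L {X} → IsQuiver X →
    (∀ p p′ → p < p′ → p′ ≤ length L → R (μs (take p′ L) (μs (reverse L) X)) (μs (take p L) (μs (reverse L) X))) →
    AllPairs R (traj (reverse L) X)
  traj-reverse-AllPairs L {X} isX r =
    traj-AllPairs (reverse L) X λ q q′ q<q′ q′≤ →
      let q′≤L = subst (q′ ≤_) (length-reverse L) q′≤
      in  R-resp (≈Q-sym (μs-take-reverse L isX q (≤-trans (<⇒≤ q<q′) q′≤L)))
                 (≈Q-sym (μs-take-reverse L isX q′ q′≤L))
                 (r (length L ∸ q′) (length L ∸ q) (∸-monoʳ-< q<q′ q′≤L) (m∸n≤m (length L) q))

module _ {A : Set} {R : A → A → Set} where

  AllPairs-++⁻ʳ : ∀ (xs : List A) {ys} → AllPairs R (xs ++ ys) → AllPairs R ys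
  AllPairs-++⁻ʳ []       rs       = rs
  AllPairs-++⁻ʳ (x ∷ xs) (_ ∷ rs) = AllPairs-++⁻ʳ xs rs

  AllPairs-between : ∀ (xs : List A) {ys x y} → AllPairs R (xs ++ ys) → x ∈ xs → y ∈ ys → R x y
  AllPairs-between (_ ∷ xs) (r ∷ _)  (here refl) y∈ys = All.lookup r (∈-++⁺ʳ xs y∈ys)
  AllPairs-between (_ ∷ xs) (_ ∷ rs) (there x∈xs) y∈ys = AllPairs-between xs rs x∈xs y∈ys

  Linked-++⁻ˡ : ∀ (xs : List A) {ys} → Linked R (xs ++ ys) → Linked R xs
  Linked-++⁻ˡ []           _         = []
  Linked-++⁻ˡ (x ∷ [])     _         = [-]
  Linked-++⁻ˡ (x ∷ y ∷ xs) (r ∷ rs) = r ∷ Linked-++⁻ˡ (y ∷ xs) rs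

  Linked-++⁻ʳ : ∀ (xs : List A) {ys} → Linked R (xs ++ ys) → Linked R ys
  Linked-++⁻ʳ []       rs = rs
  Linked-++⁻ʳ (x ∷ xs) rs = Linked-++⁻ʳ xs (Linked.tail rs)

  Linked-junction : ∀ (xs : List A) {x y ys} → Linked R (xs ++ x ∷ y ∷ ys) → R x y
  Linked-junction []       (r ∷ _) = r
  Linked-junction (_ ∷ xs) rs      = Linked-junction xs (Linked.tail rs)

Ordered : Arrows n → List (Fin n) → Set
Ordered T = AllPairs (λ s t → 0 < T s t)

module _ {T : Arrows n} (isT : IsQuiver T) where

  Ordered-disjoint : ∀ (xs : List (Fin n)) {ys x} → Ordered T (xs ++ ys) → x ∈ ys → x ∉ xs
  Ordered-disjoint xs ord x∈ys x∈xs = no-loop isT (AllPairs-between xs ord x∈xs x∈ys)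

  sourceSequence⇒no-back-arrows : ∀ S → SourceSequence T S → AllPairs (λ s t → T t s ≡ 0) S
  sourceSequence⇒no-back-arrows []      _  = []
  sourceSequence⇒no-back-arrows (s ∷ R) ss =
    All.tabulate no-back-arrow ∷ sourceSequence⇒no-back-arrows R (λ i j i→j → ≤-pred (ss (suc i) (suc j) i→j))
    where
    no-back-arrow : ∀ {t} → t ∈ R → T t s ≡ 0
    no-back-arrow t∈R = n≤0⇒n≡0 (≮⇒≥ λ t→s →
      n≮0 (ss (suc (index t∈R)) zero (subst (λ u → 0 < T u s) (lookup-index t∈R) t→s)))

  -- A repeated vertex would have no arrows to or from its successor.
  no-back-arrows⇒Ordered : Abundantʷ T → ∀ {S} → AllPairs (λ s t → T t s ≡ 0) S → Linked _≢_ S → Ordered T S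
  no-back-arrows⇒Ordered abT []                _  = []
  no-back-arrows⇒Ordered abT (back ∷ backs) lk =
    All.tabulate (λ t∈R → no-reverse⇒arrow isT abT (λ { refl → s∉R backs lk back t∈R }) (All.lookup back t∈R)) ∷
    no-back-arrows⇒Ordered abT backs (Linked.tail lk)
    where
    s∉R : ∀ {s R} → AllPairs (λ s t → T t s ≡ 0) R → Linked _≢_ (s ∷ R) → All (λ t → T t s ≡ 0) R → s ∉ R
    s∉R _               (s≢r ∷ _) _             (here s≡r)   = s≢r s≡r
    s∉R {s} {r ∷ _} (back-r ∷ _) (s≢r ∷ _) (r→s≡0 ∷ _) (there s∈R′) =
      contradiction (abT s r s≢r) (λ 2≤w → n≮0 (subst (2 ≤_) (cong₂ _+_ (All.lookup back-r s∈R′) r→s≡0) 2≤w))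

infix 4 _∈?_
infix 5.5 _∈ᵇ_

_∈?_ : (x : Fin n) (P : List (Fin n)) → Dec (x ∈ P)
_∈?_ = DecMembership._∈?_ _≟_

_∈ᵇ_ : Fin n → List (Fin n) → Bool
x ∈ᵇ P = does (x ∈? P)

∈ᵇ-∷ʳ-self : ∀ (P : List (Fin n)) s → s ∈ᵇ P ∷ʳ s ≡ true
∈ᵇ-∷ʳ-self P s = dec-true (s ∈? P ∷ʳ s) (∈-++⁺ʳ P (here refl))

∈ᵇ-∷ʳ-other : ∀ (P : List (Fin n)) {s x} → x ≢ s → x ∈ᵇ P ∷ʳ s ≡ x ∈ᵇ P
∈ᵇ-∷ʳ-other P {s} {x} x≢s with x ∈? P
... | yes x∈P = dec-true (x ∈? P ∷ʳ s) (∈-++⁺ˡ x∈P)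
... | no x∉P = dec-false (x ∈? P ∷ʳ s) λ x∈P∷ʳs → not-in-either (∈-++⁻ P x∈P∷ʳs)
  where
  not-in-either : x ∈ P ⊎ x ∈ s ∷ [] → ⊥
  not-in-either (inj₁ x∈P)        = x∉P x∈P
  not-in-either (inj₂ (here x≡s)) = x≢s x≡s

reverseCut : List (Fin n) → Arrows n → Arrows n
reverseCut P T x y = if x ∈ᵇ P xor y ∈ᵇ P then T y x else T x y

module _ (P : List (Fin n)) (T : Arrows n) where

  reverseCut-by : ∀ {x y b c} → x ∈ᵇ P ≡ b → y ∈ᵇ P ≡ c →
                  reverseCut P T x y ≡ (if b xor c then T y x else T x y)
  reverseCut-by refl refl = refl

  reverseCut-weight : ∀ x y → weight (reverseCut P T) x y ≡ weight T x y
  reverseCut-weight x y with x ∈ᵇ P | y ∈ᵇ P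
  ... | true  | true  = refl
  ... | true  | false = +-comm (T y x) (T x y)
  ... | false | true  = +-comm (T y x) (T x y)
  ... | false | false = refl

  reverseCut-isQuiver : IsQuiver T → IsQuiver (reverseCut P T)
  reverseCut-isQuiver (noLoop , no2Cycle) = loopless , no2Cycle′
    where
    loopless : ∀ x → reverseCut P T x x ≡ 0
    loopless x with x ∈ᵇ P
    ... | true  = noLoop x
    ... | false = noLoop x
    no2Cycle′ : ∀ x y → reverseCut P T x y ≡ 0 ⊎ reverseCut P T y x ≡ 0
    no2Cycle′ x y with x ∈ᵇ P | y ∈ᵇ P
    ... | true  | true  = no2Cycle x y
    ... | true  | false = swap (no2Cycle x y)
    ... | false | true  = swap (no2Cycle x y)
    ... | false | false = no2Cycle x y

  reverseCut-same : ∀ {x y} → x ∈ᵇ P ≡ y ∈ᵇ P → reverseCut P T x y ≡ T x y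
  reverseCut-same {x} {y} same rewrite same = cong (λ b → if b then T y x else T x y) (xor-same (y ∈ᵇ P))

  reverseCut-opposite : ∀ {x y} → x ∈ᵇ P ≡ not (y ∈ᵇ P) → reverseCut P T x y ≡ T y x
  reverseCut-opposite {x} {y} opposite with y ∈ᵇ P
  ... | true  rewrite opposite = refl
  ... | false rewrite opposite = refl

reverseCut-≉ : ∀ {T : Arrows n} → IsQuiver T → ∀ {P P′ x y} → 0 < T x y →
               x ∈ᵇ P ≡ y ∈ᵇ P → x ∈ᵇ P′ ≡ not (y ∈ᵇ P′) → reverseCut P T ≉Q reverseCut P′ T
reverseCut-≉ {T = T} isT {P} {P′} {x} {y} x→y same opposite P≈P′ =
  contradiction (trans (sym (reverseCut-same P T same)) (trans (P≈P′ x y) (trans (reverseCut-opposite P′ T opposite)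
                                                                               (arrow⇒no-reverse isT x→y))))
                (m<n⇒n≢0 x→y)

∈ᵇ-true : ∀ {x : Fin n} {P} → x ∈ P → x ∈ᵇ P ≡ true
∈ᵇ-true {x = x} {P} = dec-true (x ∈? P)

∈ᵇ-false : ∀ {x : Fin n} {P} → x ∉ P → x ∈ᵇ P ≡ false
∈ᵇ-false {x = x} {P} = dec-false (x ∈? P)

module _ {A : Set} where

  drop-∷ : ∀ j (xs : List A) → j < length xs → ∃[ y ] ∃[ ys ] drop j xs ≡ y ∷ ys
  drop-∷ zero    (x ∷ xs) _         = x , xs , refl
  drop-∷ (suc j) (x ∷ xs) (s≤s j<) = drop-∷ j xs j<

  ∈-take : ∀ j j′ (xs : List A) {y ys} → drop j xs ≡ y ∷ ys → j < j′ → y ∈ take j′ xs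
  ∈-take zero    (suc j′) (x ∷ xs) refl _           = here refl
  ∈-take (suc j) (suc j′) (x ∷ xs) eq   (s≤s j<j′) = there (∈-take j j′ xs eq j<j′)

  ∈-drop : ∀ j (xs : List A) {y ys} → drop j xs ≡ y ∷ ys → y ∈ xs
  ∈-drop zero    (x ∷ xs) refl = here refl
  ∈-drop (suc j) (x ∷ xs) eq   = there (∈-drop j xs eq)

module _ {T : Arrows n} where

  Ordered-head-to-later : ∀ {xs} → Ordered T xs → ∀ j {y ys} → 0 < j → drop j xs ≡ y ∷ ys →
                          ∃[ a ] (∀ {j′} → 0 < j′ → a ∈ take j′ xs) × 0 < T a y
  Ordered-head-to-later {a ∷ xs} (a→ ∷ _) (suc j) _ eq =
    a , (λ { {suc _} _ → here refl }) , All.lookup a→ (∈-drop j xs eq)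

module SourceSequenceMutation {T : Arrows n} (isT : IsQuiver T) {S : List (Fin n)}
                              (ord : Ordered T S) (cover : ∀ x → x ∈ S) where

  module _ {P R : List (Fin n)} {s : Fin n} (S≡ : S ≡ P ++ s ∷ R) where

    private
      ordPsR : Ordered T (P ++ s ∷ R)
      ordPsR = subst (Ordered T) S≡ ord
      Q = reverseCut P T
      isQ = reverseCut-isQuiver P T isT

    s∉P : s ∉ P
    s∉P = Ordered-disjoint isT P ordPsR (here refl)

    reverseCut-source : ∀ x → reverseCut P T x s ≡ 0
    reverseCut-source x with ∈-++⁻ P (subst (x ∈_) S≡ (cover x))
    ... | inj₁ x∈P =
      trans (reverseCut-opposite P T (trans (∈ᵇ-true x∈P) (cong not (sym (∈ᵇ-false s∉P)))))
            (arrow⇒no-reverse isT (AllPairs-between P ordPsR x∈P (here refl)))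
    ... | inj₂ (here refl) = trans (reverseCut-same P T refl) (proj₁ isT x)
    ... | inj₂ (there x∈R) =
      trans (reverseCut-same P T (trans (∈ᵇ-false (Ordered-disjoint isT P ordPsR (there x∈R))) (sym (∈ᵇ-false s∉P))))
            (arrow⇒no-reverse isT (All.lookup (AllPairs-head (AllPairs-++⁻ʳ P ordPsR)) x∈R))

    μ-reverseCut : μ s (reverseCut P T) ≈Q reverseCut (P ∷ʳ s) T
    μ-reverseCut x y with toSum (x ≟ s) | toSum (y ≟ s)
    ... | inj₁ refl | inj₁ refl =
      trans (μ-pivotˡ s Q s) (trans (proj₁ isQ s) (sym (proj₁ (reverseCut-isQuiver (P ∷ʳ s) T isT) s)))
    ... | inj₁ refl | inj₂ y≢s =
      trans (μ-pivotˡ s Q y) (trans (reverseCut-by P T refl (∈ᵇ-false s∉P)) (trans (flip (y ∈ᵇ P))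
            (sym (reverseCut-by (P ∷ʳ s) T (∈ᵇ-∷ʳ-self P s) (∈ᵇ-∷ʳ-other P y≢s)))))
      where
      flip : ∀ c → (if c xor false then T s y else T y s) ≡ (if true xor c then T y s else T s y)
      flip true  = refl
      flip false = refl
    ... | inj₂ x≢s | inj₁ refl =
      trans (μ-pivotʳ s Q x) (trans (reverseCut-by P T (∈ᵇ-false s∉P) refl) (trans (flip (x ∈ᵇ P))
            (sym (reverseCut-by (P ∷ʳ s) T (∈ᵇ-∷ʳ-other P x≢s) (∈ᵇ-∷ʳ-self P s)))))
      where
      flip : ∀ c → (if false xor c then T x s else T s x) ≡ (if c xor true then T s x else T x s)
      flip true  = refl
      flip false = refl
    ... | inj₂ x≢s | inj₂ y≢s =
      trans (μ-without-2-paths isQ x≢s y≢s (cong (_* Q s y) (reverseCut-source x))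
                                           (cong (_* Q s x) (reverseCut-source y)))
            (sym (reverseCut-by (P ∷ʳ s) T (∈ᵇ-∷ʳ-other P x≢s) (∈ᵇ-∷ʳ-other P y≢s)))

  μs-reverseCut : ∀ P R {Q} → S ≡ P ++ R ++ Q → μs R (reverseCut P T) ≈Q reverseCut (P ++ R) T
  μs-reverseCut P []      {Q} S≡ = subst (λ P′ → reverseCut P T ≈Q reverseCut P′ T) (sym (++-identityʳ P)) ≈Q-refl
  μs-reverseCut P (s ∷ R) {Q} S≡ =
    subst (λ P′ → μs (s ∷ R) (reverseCut P T) ≈Q reverseCut P′ T) (++-assoc P (s ∷ []) R)
      (≈Q-trans (μs-cong R (μ-reverseCut {R = R ++ Q} S≡))
                (μs-reverseCut (P ∷ʳ s) R (trans S≡ (sym (++-assoc P (s ∷ []) (R ++ Q))))))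

  μs-take-reverseCut : ∀ j → μs (take j S) T ≈Q reverseCut (take j S) T
  μs-take-reverseCut j = μs-reverseCut [] (take j S) (sym (take++drop≡id j S))

  reverseCut-complete : reverseCut S T ≈Q T
  reverseCut-complete x y = reverseCut-same S T (trans (∈ᵇ-true (cover x)) (sym (∈ᵇ-true (cover y))))

  private
    ∉-take : ∀ j {y ys} → drop j S ≡ y ∷ ys → y ∉ take j S
    ∉-take j {y} eq = Ordered-disjoint isT (take j S) (subst (Ordered T) (sym (take++drop≡id j S)) ord)
                                        (subst (y ∈_) (sym eq) (here refl))

  reverseCut-take-≉ : ∀ {j j′} → 0 < j → j < j′ → j′ ≤ length S →
                      reverseCut (take j S) T ≉Q reverseCut (take j′ S) T
  reverseCut-take-≉ {j} {j′} 0<j j<j′ j′≤ with drop-∷ j S (<-≤-trans j<j′ j′≤)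
  ... | y , ys , eq with Ordered-head-to-later ord j 0<j eq
  ...   | a , a∈ , a→y =
    ≉Q-sym (reverseCut-≉ isT {P = take j′ S} {P′ = take j S} a→y (trans (∈ᵇ-true (a∈ (<-trans 0<j j<j′))) (sym (∈ᵇ-true (∈-take j j′ S eq j<j′))))
                                 (trans (∈ᵇ-true (a∈ 0<j)) (cong not (sym (∈ᵇ-false (∉-take j eq))))))

  ≉-reverseCut-take : ∀ {j} → 0 < j → j < length S → T ≉Q reverseCut (take j S) T
  ≉-reverseCut-take {j} 0<j j< with drop-∷ j S j<
  ... | y , ys , eq with Ordered-head-to-later ord j 0<j eq
  ...   | a , a∈ , a→y =
    reverseCut-≉ isT {P = []} {P′ = take j S} a→y refl (trans (∈ᵇ-true (a∈ 0<j)) (cong not (sym (∈ᵇ-false (∉-take j eq)))))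

  reverseCut-out-degree : Abundantʷ T → ∀ {P R s} → S ≡ P ++ s ∷ R → ∀ t → t ≢ s → 2 ≤ reverseCut P T s t
  reverseCut-out-degree abT {P} {s = s} S≡ t t≢s =
    subst (2 ≤_) (trans (sym (reverseCut-weight P T s t)) (trans (cong (reverseCut P T s t +_) (reverseCut-source S≡ t))
                                                                 (+-identityʳ _)))
          (abT s t (≢-sym t≢s))

-- In glue T H A the vertices of H are never mutated; they play the role of the frozen vertices of framed T.
module Extension {n k : ℕ} where

  mutable : Fin n → Fin (n + k)
  mutable t = t ↑ˡ k

  frozen : Fin k → Fin (n + k)
  frozen h = n ↑ʳ h

  frozen≢mutable : ∀ h t → frozen h ≢ mutable t
  frozen≢mutable h t eq with trans (sym (splitAt-↑ʳ n k h)) (trans (cong (splitAt n) eq) (splitAt-↑ˡ n t k))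
  ... | ()

  mutable-injective : ∀ {t t′} → mutable t ≡ mutable t′ → t ≡ t′
  mutable-injective = ↑ˡ-injective k _ _

  mutable≢ : ∀ {t t′} → t ≢ t′ → mutable t ≢ mutable t′
  mutable≢ t≢t′ eq = t≢t′ (mutable-injective eq)

  mutablePart : Arrows (n + k) → Arrows n
  mutablePart X t t′ = X (mutable t) (mutable t′)

  mutablePart-cong : ∀ {X Z} → X ≈Q Z → mutablePart X ≈Q mutablePart Z
  mutablePart-cong X≈Z t t′ = X≈Z (mutable t) (mutable t′)

  mutablePart-μ : ∀ s X → mutablePart (μ (mutable s) X) ≈Q μ s (mutablePart X)
  mutablePart-μ s X x y with toSum (x ≟ s) | toSum (y ≟ s)
  ... | inj₁ refl | _ = trans (μ-pivotˡ (mutable s) X (mutable y)) (sym (μ-pivotˡ s (mutablePart X) y))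
  ... | inj₂ _ | inj₁ refl = trans (μ-pivotʳ (mutable s) X (mutable x)) (sym (μ-pivotʳ s (mutablePart X) x))
  ... | inj₂ x≢s | inj₂ y≢s =
    trans (μ-away (mutable s) X (mutable≢ x≢s) (mutable≢ y≢s)) (sym (μ-away s (mutablePart X) x≢s y≢s))

  mutablePart-μs : ∀ L X → mutablePart (μs (map mutable L) X) ≈Q μs L (mutablePart X)
  mutablePart-μs []      X = ≈Q-refl
  mutablePart-μs (s ∷ L) X = ≈Q-trans (mutablePart-μs L (μ (mutable s) X)) (μs-cong L (mutablePart-μ s X))

  mutablePart-μs-take : ∀ L r X → mutablePart (μs (take r (map mutable L)) X) ≈Q μs (take r L) (mutablePart X)
  mutablePart-μs-take L r X rewrite take-map {f = mutable} r L = mutablePart-μs (take r L) X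

  mutablePart-≉ : ∀ {X Z P Q} → mutablePart X ≈Q P → mutablePart Z ≈Q Q → P ≉Q Q → X ≉Q Z
  mutablePart-≉ X≈P Z≈Q P≉Q X≈Z = P≉Q (≈Q-trans (≈Q-sym X≈P) (≈Q-trans (mutablePart-cong X≈Z) Z≈Q))

  module _ (P : Arrows n) (H : Arrows k) (A : Fin n → Fin k → ℕ) where

    glue-mutable : ∀ t t′ → glue P H A (mutable t) (mutable t′) ≡ P t t′
    glue-mutable t t′ rewrite splitAt-↑ˡ n t k | splitAt-↑ˡ n t′ k = refl

    glue-to-frozen : ∀ t h → glue P H A (mutable t) (frozen h) ≡ A t h
    glue-to-frozen t h rewrite splitAt-↑ˡ n t k | splitAt-↑ʳ n k h = refl

    glue-from-frozen : ∀ h t → glue P H A (frozen h) (mutable t) ≡ 0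
    glue-from-frozen h t rewrite splitAt-↑ʳ n k h | splitAt-↑ˡ n t k = refl

    glue-isQuiver : IsQuiver P → IsQuiver H → IsQuiver (glue P H A)
    glue-isQuiver (noLoopP , no2CycleP) (noLoopH , no2CycleH) = loopless , no2Cycle
      where
      loopless : ∀ x → glue P H A x x ≡ 0
      loopless x with splitAt n x
      ... | inj₁ t = noLoopP t
      ... | inj₂ h = noLoopH h
      no2Cycle : ∀ x y → glue P H A x y ≡ 0 ⊎ glue P H A y x ≡ 0
      no2Cycle x y with splitAt n x | splitAt n y
      ... | inj₁ t | inj₁ t′ = no2CycleP t t′
      ... | inj₁ _ | inj₂ _  = inj₂ refl
      ... | inj₂ _ | inj₁ _  = inj₁ refl
      ... | inj₂ h | inj₂ h′ = no2CycleH h h′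

  μ-keeps-no-arrow-from : ∀ {X h s t} → t ≢ s → X (frozen h) (mutable t) ≡ 0 → X (frozen h) (mutable s) ≡ 0 →
                          μ (mutable s) X (frozen h) (mutable t) ≡ 0
  μ-keeps-no-arrow-from {X} {h} {s} {t} t≢s h↛t h↛s =
    trans (μ-away (mutable s) X (frozen≢mutable h s) (mutable≢ t≢s))
          (trans (cong (_∸ back) (cong₂ (λ a b → a + b * X (mutable s) (mutable t)) h↛t h↛s)) (0∸n≡0 back))
    where back = X (mutable t) (frozen h) + X (mutable t) (mutable s) * X (mutable s) (frozen h)

  record Detached (X : Arrows (n + k)) (s : Fin n) (h : Fin k) : Set where
    constructor detached
    field
      no-arrow-to   : X (mutable s) (frozen h) ≡ 0
      no-arrow-from : X (frozen h) (mutable s) ≡ 0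

  record SameColumn (h : Fin k) (X Z : Arrows (n + k)) : Set where
    constructor same-column
    field
      same-to   : ∀ t → X (mutable t) (frozen h) ≡ Z (mutable t) (frozen h)
      same-from : ∀ t → X (frozen h) (mutable t) ≡ Z (frozen h) (mutable t)

  open Detached
  open SameColumn

  SameColumn-sym : ∀ {h X Z} → SameColumn h X Z → SameColumn h Z X
  SameColumn-sym (same-column to from) = same-column (λ t → sym (to t)) (λ t → sym (from t))

  SameColumn-trans : ∀ {h X Y Z} → SameColumn h X Y → SameColumn h Y Z → SameColumn h X Z
  SameColumn-trans (same-column to from) (same-column to′ from′) =
    same-column (λ t → trans (to t) (to′ t)) (λ t → trans (from t) (from′ t))

  SameColumn-Detached : ∀ {h X Z s} → SameColumn h X Z → Detached X s h → Detached Z s h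
  SameColumn-Detached {s = s} (same-column to from) (detached s↛h h↛s) =
    detached (trans (sym (to s)) s↛h) (trans (sym (from s)) h↛s)

  μ-detached : ∀ {X s h} → IsQuiver X → Detached X s h → SameColumn h (μ (mutable s) X) X
  μ-detached {X} {s} {h} isX (detached s↛h h↛s) = same-column (λ t → proj₁ (column t)) (λ t → proj₂ (column t))
    where
    column : ∀ t → μ (mutable s) X (mutable t) (frozen h) ≡ X (mutable t) (frozen h)
                 × μ (mutable s) X (frozen h) (mutable t) ≡ X (frozen h) (mutable t)
    column t with toSum (t ≟ s)
    ... | inj₁ refl = trans (μ-pivotˡ (mutable s) X (frozen h)) (trans h↛s (sym s↛h)) ,
                      trans (μ-pivotʳ (mutable s) X (frozen h)) (trans s↛h (sym h↛s))
    ... | inj₂ t≢s =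
      μ-without-2-paths isX (mutable≢ t≢s) (frozen≢mutable h s) t⇝h⇝t≡0 (cong (_* X (mutable s) (mutable t)) h↛s) ,
      μ-without-2-paths isX (frozen≢mutable h s) (mutable≢ t≢s) (cong (_* X (mutable s) (mutable t)) h↛s) t⇝h⇝t≡0
      where
      t⇝h⇝t≡0 : X (mutable t) (mutable s) * X (mutable s) (frozen h) ≡ 0
      t⇝h⇝t≡0 = trans (cong (X (mutable t) (mutable s) *_) s↛h) (*-zeroʳ (X (mutable t) (mutable s)))

  μs-detached : ∀ {X h} (L : List (Fin n)) → IsQuiver X → (∀ s → s ∈ L → Detached X s h) →
                SameColumn h (μs (map mutable L) X) X
  μs-detached []      isX _        = same-column (λ _ → refl) (λ _ → refl)
  μs-detached (s ∷ L) isX detachedL =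
    SameColumn-trans (μs-detached L (μ-isQuiver (mutable s) isX)
                       (λ s′ s′∈L → SameColumn-Detached (SameColumn-sym same) (detachedL s′ (there s′∈L))))
                     same
    where same = μ-detached isX (detachedL s (here refl))

-- A vertex x that is never mutated keeps its single arrow x → x′ in the framed quiver.
reddening⇒covers : ∀ {T : Arrows n} → IsQuiver T → ∀ {S} → Reddening T S → ∀ x → x ∈ S
reddening⇒covers {n} {T} isT {S} red x with x ∈? S
... | yes x∈S = x∈S
... | no x∉S = ⊥-elim (1⊖0≰0 (subst₂ (λ a b → a ⊖ b ≤ℤ 0ℤ) to-x′ from-x′ (red x x)))
  where
  open Extension {n} {n}
  X = μs (map mutable S) (framed T)
  never-mutated : ∀ s → s ∈ S → Detached (framed T) s x
  never-mutated s s∈S =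
    detached (trans (glue-to-frozen T (I n) idMat s x)
                    (cong (λ b → if b then 1 else 0) (dec-false (s ≟ x) λ { refl → x∉S s∈S })))
             (glue-from-frozen T (I n) idMat x s)
  same : SameColumn x X (framed T)
  same = μs-detached S (glue-isQuiver T (I n) idMat isT (I-isQuiver n)) never-mutated
  to-x′ : X (mutable x) (frozen x) ≡ 1
  to-x′ = trans (SameColumn.same-to same x)
                (trans (glue-to-frozen T (I n) idMat x x) (cong (λ b → if b then 1 else 0) (dec-true (x ≟ x) refl)))
  from-x′ : X (frozen x) (mutable x) ≡ 0
  from-x′ = trans (SameColumn.same-from same x) (glue-from-frozen T (I n) idMat x x)
  1⊖0≰0 : ¬ (1 ⊖ 0 ≤ℤ 0ℤ)
  1⊖0≰0 (+≤+ ())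

m∸n+n≡n∸m+m : ∀ m n → m ∸ n + n ≡ n ∸ m + m
m∸n+n≡n∸m+m m n with ≤-total m n
... | inj₁ m≤n rewrite m≤n⇒m∸n≡0 m≤n = sym (m∸n+n≡m m≤n)
... | inj₂ n≤m rewrite m≤n⇒m∸n≡0 n≤m = m∸n+n≡m n≤m

m+o≡n+p⇒p<o⇒m<n : ∀ {m n o p} → m + o ≡ n + p → p < o → m < n
m+o≡n+p⇒p<o⇒m<n {m} {n} eq p<o with m <? n
... | yes m<n = m<n
... | no m≮n = contradiction (sym eq) (<⇒≢ (+-mono-≤-< (≮⇒≥ m≮n) p<o))

term≤sum : ∀ {m} (f : Fin m → ℕ) i → f i ≤ sum f
term≤sum f zero    = m≤m+n (f zero) _
term≤sum f (suc i) = ≤-trans (term≤sum (λ t → f (suc t)) i) (m≤n+m _ (f zero))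

pair≤sum : ∀ {m} (f : Fin m → ℕ) {i j} → i ≢ j → f i + f j ≤ sum f
pair≤sum {suc m} f {i} {j} i≢j =
  subst (f i + f j ≤_) (sym (sum-remove {i = i} f))
    (+-monoʳ-≤ (f i) (subst (_≤ sum (λ t → f (punchIn i t))) (cong f (punchIn-punchOut i≢j)) (term≤sum (λ t → f (punchIn i t)) (punchOut i≢j))))

sum-agree-off : ∀ {m} (f g : Fin m → ℕ) s {a b} → (∀ t → t ≢ s → f t ≡ g t) → f s + a ≡ g s + b →
                sum f + a ≡ sum g + b
sum-agree-off {suc m} f g s {a} {b} off at = begin
  sum f + a                                        ≡⟨ cong (_+ a) (sum-remove {i = s} f) ⟩
  f s + sum (λ t → f (punchIn s t)) + a             ≡⟨ swap-last (f s) _ a ⟩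
  f s + a + sum (λ t → f (punchIn s t))             ≡⟨ cong₂ _+_ at (sum-cong-≗ (λ t → off (punchIn s t) (punchInᵢ≢i s t))) ⟩
  g s + b + sum (λ t → g (punchIn s t))             ≡⟨ swap-last (g s) _ b ⟨
  g s + sum (λ t → g (punchIn s t)) + b             ≡⟨ cong (_+ b) (sum-remove {i = s} g) ⟨
  sum g + b                                        ∎
  where
  open ≡-Reasoning
  swap-last : ∀ x y z → x + y + z ≡ x + z + y
  swap-last = solve-∀

module FrozenPotential {n k : ℕ} (h : Fin k) where

  open Extension {n} {k}

  Φ⁺ Φ⁻ : Arrows (n + k) → ℕ
  Φ⁺ X = sum (λ t → X (mutable t) (frozen h))
  Φ⁻ X = sum (λ t → X (frozen h) (mutable t))

  -- The potential Φ⁺ − Φ⁻ of the column of h drops strictly from X to Z (compared without subtraction).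
  infix 4 _≻_
  _≻_ : Arrows (n + k) → Arrows (n + k) → Set
  X ≻ Z = Φ⁺ Z + Φ⁻ X < Φ⁺ X + Φ⁻ Z

  ≻-trans : ∀ {X Y Z} → X ≻ Y → Y ≻ Z → X ≻ Z
  ≻-trans {X} {Y} {Z} X≻Y Y≻Z =
    +-cancelʳ-< (Φ⁺ Y + Φ⁻ Y) (Φ⁺ Z + Φ⁻ X) (Φ⁺ X + Φ⁻ Z)
      (subst₂ _<_ (shuffle (Φ⁺ Y) (Φ⁻ X) (Φ⁺ Z) (Φ⁻ Y)) (shuffle′ (Φ⁺ X) (Φ⁻ Y) (Φ⁺ Y) (Φ⁻ Z)) (+-mono-< X≻Y Y≻Z))
    where
    shuffle : ∀ a b c d → (a + b) + (c + d) ≡ (c + b) + (a + d)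
    shuffle = solve-∀
    shuffle′ : ∀ a b c d → (a + b) + (c + d) ≡ (a + d) + (c + b)
    shuffle′ = solve-∀

  ≻-respʳ : ∀ {X Y Z} → SameColumn h Z Y → X ≻ Y → X ≻ Z
  ≻-respʳ {X} (same-column to from) = subst₂ _<_ (cong (_+ Φ⁻ X) (sum-cong-≗ (λ t → sym (to t))))
                                                 (cong (Φ⁺ X +_) (sum-cong-≗ (λ t → sym (from t))))

  ≻-respˡ : ∀ {X Y Z} → SameColumn h Y X → Y ≻ Z → X ≻ Z
  ≻-respˡ {Z = Z} (same-column to from) = subst₂ _<_ (cong (Φ⁺ Z +_) (sum-cong-≗ from))
                                                     (cong (_+ Φ⁻ Z) (sum-cong-≗ to))

  ≻⇒≉ : ∀ {X Z} → X ≻ Z → X ≉Q Z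
  ≻⇒≉ X≻Z X≈Z = <-irrefl (cong₂ _+_ (sum-cong-≗ (λ t → sym (X≈Z (mutable t) (frozen h))))
                                     (sum-cong-≗ (λ t → X≈Z (frozen h) (mutable t)))) X≻Z

  outDegree : Arrows (n + k) → Fin n → ℕ
  outDegree X s = sum (λ t → X (mutable s) (mutable t))

  module _ {X : Arrows (n + k)} {s : Fin n} (isX : IsQuiver X) (source : ∀ t → X (mutable t) (mutable s) ≡ 0) where

    private
      X′ = μ (mutable s) X
      p = X (mutable s) (frozen h)
      d = X (frozen h) (mutable s)

    -- Mutating at a source s changes Φ⁺ − Φ⁻ by 2 (d − p) − d · outDegree X s.
    μ-potential-balance : Φ⁺ X′ + Φ⁻ X + (d * outDegree X s + (p + p)) ≡ Φ⁺ X + Φ⁻ X′ + (d + d)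
    μ-potential-balance = begin
      Φ⁺ X′ + Φ⁻ X + (d * outDegree X s + (p + p))   ≡⟨ regroup (Φ⁺ X′) (Φ⁻ X) (d * outDegree X s) (p + p) ⟩
      Φ⁺ X′ + (Φ⁻ X + d * outDegree X s) + (p + p)   ≡⟨ cong (_+ (p + p)) (sym sum-L) ⟩
      sum L + (p + p)                               ≡⟨ sum-agree-off L R s L≡R L≡R-at-s ⟩
      sum R + (d + d)                               ≡⟨ cong (_+ (d + d)) (trans (∑-distrib-+ (λ t → X′ (frozen h) (mutable t)) (λ t → X (mutable t) (frozen h)))
                                                                      (+-comm (Φ⁻ X′) (Φ⁺ X))) ⟩
      Φ⁺ X + Φ⁻ X′ + (d + d)                         ∎
      where
      open ≡-Reasoning
      regroup : ∀ a b c e → a + b + (c + e) ≡ a + (b + c) + e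
      regroup = solve-∀
      α β : Fin n → ℕ
      α t = X (mutable t) (frozen h) + X (mutable t) (mutable s) * p
      β t = X (frozen h) (mutable t) + d * X (mutable s) (mutable t)
      L R : Fin n → ℕ
      L t = X′ (mutable t) (frozen h) + β t
      R t = X′ (frozen h) (mutable t) + X (mutable t) (frozen h)
      sum-L : sum L ≡ Φ⁺ X′ + (Φ⁻ X + d * outDegree X s)
      sum-L = trans (∑-distrib-+ (λ t → X′ (mutable t) (frozen h)) β)
                    (cong (Φ⁺ X′ +_) (trans (∑-distrib-+ (λ t → X (frozen h) (mutable t)) (λ t → d * X (mutable s) (mutable t)))
                    (cong (Φ⁻ X +_) (sym (*-distribˡ-sum d (λ t → X (mutable s) (mutable t)))))))
      L≡R : ∀ t → t ≢ s → L t ≡ R t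
      L≡R t t≢s = begin
        X′ (mutable t) (frozen h) + β t   ≡⟨ cong (_+ β t) (μ-away (mutable s) X (mutable≢ t≢s) (frozen≢mutable h s)) ⟩
        α t ∸ β t + β t                   ≡⟨ m∸n+n≡n∸m+m (α t) (β t) ⟩
        β t ∸ α t + α t                   ≡⟨ cong₂ _+_ (sym (μ-away (mutable s) X (frozen≢mutable h s) (mutable≢ t≢s)))
                                                   (trans (cong (λ a → X (mutable t) (frozen h) + a * p) (source t))
                                                          (+-identityʳ _)) ⟩
        R t                               ∎
      L≡R-at-s : L s + (p + p) ≡ R s + (d + d)
      L≡R-at-s = begin
        X′ (mutable s) (frozen h) + (d + d * X (mutable s) (mutable s)) + (p + p)
          ≡⟨ cong₂ (λ a b → a + (d + d * b) + (p + p)) (μ-pivotˡ (mutable s) X (frozen h)) (proj₁ isX (mutable s)) ⟩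
        d + (d + d * 0) + (p + p)
          ≡⟨ rearrange d p ⟩
        p + p + (d + d)
          ≡⟨ cong (λ a → a + p + (d + d)) (sym (μ-pivotʳ (mutable s) X (frozen h))) ⟩
        R s + (d + d) ∎
        where
        rearrange : ∀ d p → d + (d + d * 0) + (p + p) ≡ p + p + (d + d)
        rearrange = solve-∀

    μ-potential : d ≡ 0 ⊎ 3 ≤ outDegree X s → X ≻ X′ ⊎ Detached X s h
    μ-potential condition with 0 <? d | 0 <? p
    ... | no d≯0 | no p≯0 = inj₂ (detached (n≤0⇒n≡0 (≮⇒≥ p≯0)) (n≤0⇒n≡0 (≮⇒≥ d≯0)))
    ... | no d≯0 | yes 0<p =
      inj₁ (m+o≡n+p⇒p<o⇒m<n μ-potential-balance
              (subst (λ x → x + x < x * outDegree X s + (p + p)) (sym (n≤0⇒n≡0 (≮⇒≥ d≯0))) (<-≤-trans 0<p (m≤m+n p p))))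
    ... | yes 0<d | _ with condition
    ...   | inj₁ d≡0 = contradiction d≡0 (m<n⇒n≢0 0<d)
    ...   | inj₂ 3≤D =
      inj₁ (m+o≡n+p⇒p<o⇒m<n μ-potential-balance
              (subst (λ x → d + d < d * outDegree X s + (x + x)) (sym (arrow⇒no-reverse isX 0<d))
                     (<-≤-trans d+d<d*3 (≤-trans (*-monoʳ-≤ d 3≤D) (m≤m+n _ 0)))))
      where
      d+d<d*3 : d + d < d * 3
      d+d<d*3 = subst (d + d <_) (*-comm 3 d) (+-monoʳ-< d (m<m+n d (subst (0 <_) (sym (+-identityʳ d)) 0<d)))

  SourceSteps : List (Fin n) → Arrows (n + k) → Set
  SourceSteps []      X = ⊤
  SourceSteps (s ∷ L) X = IsQuiver X × (∀ t → X (mutable t) (mutable s) ≡ 0)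
                        × (X (frozen h) (mutable s) ≡ 0 ⊎ 3 ≤ outDegree X s) × SourceSteps L (μ (mutable s) X)

  μs-potential : ∀ L {X} → SourceSteps L X → X ≻ μs (map mutable L) X ⊎ (∀ s → s ∈ L → Detached X s h)
  μs-potential []      _ = inj₂ (λ _ ())
  μs-potential (s ∷ L) {X} (isX , source , condition , steps)
    with μ-potential isX source condition | μs-potential L steps
  ... | inj₁ X≻X′ | inj₁ X′≻Z =
    inj₁ (≻-trans {X} {μ (mutable s) X} {μs (map mutable (s ∷ L)) X} X≻X′ X′≻Z)
  ... | inj₁ X≻X′ | inj₂ detachedL =
    inj₁ (≻-respʳ {X} (μs-detached L (μ-isQuiver (mutable s) isX) detachedL) X≻X′)
  ... | inj₂ s-detached | inj₁ X′≻Z =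
    inj₁ (≻-respˡ {Z = μs (map mutable (s ∷ L)) X} (μ-detached isX s-detached) X′≻Z)
  ... | inj₂ s-detached | inj₂ detachedL = inj₂ all-detached
    where
    all-detached : ∀ s′ → s′ ∈ s ∷ L → Detached X s′ h
    all-detached _  (here refl)   = s-detached
    all-detached s′ (there s′∈L) = SameColumn-Detached (μ-detached isX s-detached) (detachedL s′ s′∈L)

ThreeDistinct : ℕ → Set
ThreeDistinct n = Σ[ a ∈ Fin n ] Σ[ b ∈ Fin n ] Σ[ c ∈ Fin n ] a ≢ b × a ≢ c × b ≢ c

two-others : ThreeDistinct n → ∀ s → ∃[ t₁ ] ∃[ t₂ ] t₁ ≢ t₂ × t₁ ≢ s × t₂ ≢ s
two-others (a , b , c , a≢b , a≢c , b≢c) s with toSum (s ≟ a) | toSum (s ≟ b)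
... | inj₁ refl | _        = b , c , b≢c , ≢-sym a≢b , ≢-sym a≢c
... | inj₂ s≢a | inj₁ refl = a , c , a≢c , a≢b , ≢-sym b≢c
... | inj₂ s≢a | inj₂ s≢b  = a , b , a≢b , ≢-sym s≢a , ≢-sym s≢b

module SourceSequenceOnColumn {n k : ℕ} {T : Arrows n} (isT : IsQuiver T) (abT : Abundantʷ T)
                              {S : List (Fin n)} (ord : Ordered T S) (cover : ∀ x → x ∈ S) (h : Fin k) where

  open Extension {n} {k}
  open FrozenPotential {n} {k} h
  open SourceSequenceMutation isT ord cover

  -- Each alternative rules out the one bad step of μ-potential (d > 0 with out-degree ≤ 2): three
  -- vertices make every out-degree at least 4, and otherwise h has no arrows into unmutated vertices.
  FrozenCondition : List (Fin n) → Arrows (n + k) → Set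
  FrozenCondition P X = ThreeDistinct n ⊎ (∀ t → t ∉ P → X (frozen h) (mutable t) ≡ 0)

  sourceSteps : ∀ P R {X} → S ≡ P ++ R → IsQuiver X → mutablePart X ≈Q reverseCut P T →
                FrozenCondition P X → SourceSteps R X
  sourceSteps P []      _  _   _   _         = tt
  sourceSteps P (s ∷ R) {X} S≡ isX X≈cut condition =
    isX , source , step-condition condition ,
    sourceSteps (P ∷ʳ s) R (trans S≡ (sym (++-assoc P (s ∷ []) R))) (μ-isQuiver (mutable s) isX)
      (≈Q-trans (mutablePart-μ s X) (≈Q-trans (μ-cong s X≈cut) (μ-reverseCut S≡))) (next-condition condition)
    where
    source : ∀ t → X (mutable t) (mutable s) ≡ 0
    source t = trans (X≈cut t s) (reverseCut-source S≡ t)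
    out-degree : ∀ t → t ≢ s → 2 ≤ X (mutable s) (mutable t)
    out-degree t t≢s = subst (2 ≤_) (sym (X≈cut s t)) (reverseCut-out-degree abT S≡ t t≢s)
    step-condition : FrozenCondition P X → X (frozen h) (mutable s) ≡ 0 ⊎ 3 ≤ outDegree X s
    step-condition (inj₂ h↛) = inj₁ (h↛ s (s∉P S≡))
    step-condition (inj₁ three) with two-others three s
    ... | t₁ , t₂ , t₁≢t₂ , t₁≢s , t₂≢s =
      inj₂ (≤-trans (s≤s (s≤s (s≤s z≤n)))
                    (≤-trans (+-mono-≤ (out-degree t₁ t₁≢s) (out-degree t₂ t₂≢s))
                             (pair≤sum (λ t → X (mutable s) (mutable t)) t₁≢t₂)))
    next-condition : FrozenCondition P X → FrozenCondition (P ∷ʳ s) (μ (mutable s) X)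
    next-condition (inj₁ three) = inj₁ three
    next-condition (inj₂ h↛) = inj₂ λ t t∉P∷ʳs →
      μ-keeps-no-arrow-from {X} (λ t≡s → t∉P∷ʳs (∈-++⁺ʳ P (here t≡s)))
                            (h↛ t (λ t∈P → t∉P∷ʳs (∈-++⁺ˡ t∈P))) (h↛ s (s∉P S≡))

  μs-moves-column : ∀ {X} → IsQuiver X → mutablePart X ≈Q T → ¬ (∀ t → Detached X t h) →
                    FrozenCondition [] X → X ≉Q μs (map mutable S) X
  μs-moves-column {X} isX X≈T nonzero condition with μs-potential S (sourceSteps [] S refl isX X≈T condition)
  ... | inj₁ X≻ = ≻⇒≉ {X} X≻
  ... | inj₂ detachedS = λ _ → nonzero (λ t → detachedS t (cover t))

reduced⇒≢first : ∀ {A : Set} (M′ : List A) {m a S₁} →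
                 Linked _≢_ (reverse (m ∷ M′) ++ (a ∷ S₁) ++ m ∷ M′) → m ≢ a
reduced⇒≢first M′ {m} {a} {S₁} reduced =
  Linked-junction (reverse M′)
    (subst (Linked _≢_) (trans (cong (_++ rest) (unfold-reverse m M′)) (++-assoc (reverse M′) (m ∷ []) rest)) reduced)
  where rest = (a ∷ S₁) ++ m ∷ M′

reduced⇒≢last : ∀ {A : Set} (M′ : List A) {m l I} →
                Linked _≢_ (reverse (m ∷ M′) ++ (I ∷ʳ l) ++ m ∷ M′) → m ≢ l
reduced⇒≢last M′ {m} {l} {I} reduced =
  ≢-sym (Linked-junction (reverse (m ∷ M′) ++ I)
          (subst (Linked _≢_) (trans (cong (reverse (m ∷ M′) ++_) (++-assoc I (l ∷ []) (m ∷ M′)))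
                                     (sym (++-assoc (reverse (m ∷ M′)) I _)))
                 reduced))

module _ {T : Arrows n} (isT : IsQuiver T) where

  Ordered-from-first : ∀ S → Ordered T S → ∀ {m} → m ∈ S → (∀ {a S₁} → S ≡ a ∷ S₁ → m ≢ a) → ∃[ a ] 0 < T a m
  Ordered-from-first (a ∷ S₁) (a→ ∷ _) (here refl)  ≢first = ⊥-elim (≢first refl refl)
  Ordered-from-first (a ∷ S₁) (a→ ∷ _) (there m∈S₁) ≢first = a , All.lookup a→ m∈S₁

  Ordered-to-last : ∀ S → Ordered T S → ∀ {m} → m ∈ S → (∀ {I l} → S ≡ I ∷ʳ l → m ≢ l) → ∃[ l ] 0 < T m l
  Ordered-to-last S ord m∈S ≢last with initLast S
  Ordered-to-last .(I ∷ʳ l) ord {m} m∈S ≢last | I ∷ʳ′ l with ∈-++⁻ I m∈S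
  ... | inj₁ m∈I          = l , AllPairs-between I ord m∈I (here refl)
  ... | inj₂ (here m≡l)   = ⊥-elim (≢last refl m≡l)

module ReducedSequence {T : Arrows n} (isT : IsQuiver T) (abT : Abundantʷ T) (acT : Acyclic T)
                       {S : List (Fin n)} (ord : Ordered T S) (cover : ∀ x → x ∈ S) where

  module _ (m : Fin n) (M′ : List (Fin n)) (reduced : Linked _≢_ (reverse (m ∷ M′) ++ S ++ m ∷ M′)) where

    interior-in : ∃[ a ] 0 < T a m
    interior-in = Ordered-from-first isT S ord (cover m) λ S≡ →
      reduced⇒≢first M′ (subst (λ S′ → Linked _≢_ (reverse (m ∷ M′) ++ S′ ++ m ∷ M′)) S≡ reduced)

    interior-out : ∃[ l ] 0 < T m l
    interior-out = Ordered-to-last isT S ord (cover m) λ S≡ →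
      reduced⇒≢last M′ (subst (λ S′ → Linked _≢_ (reverse (m ∷ M′) ++ S′ ++ m ∷ M′)) S≡ reduced)

    interior-ThreeDistinct : ThreeDistinct n
    interior-ThreeDistinct with interior-in | interior-out
    ... | a , a→m | l , m→l =
      m , a , l , ≢-sym (arrow⇒≢ isT a→m) , arrow⇒≢ isT m→l ,
      arrow⇒≢ isT (abundant-acyclic⇒transitive isT abT acT a→m m→l)

  reduced-increasing : ∀ M → Linked _≢_ (reverse M ++ S ++ M) →
                       ∀ r r′ → r < r′ → r′ ≤ length M → μs (take r M) T ⊏ μs (take r′ M) T
  reduced-increasing []       _       r r′ r<r′ r′≤0 = contradiction (<-≤-trans r<r′ r′≤0) n≮0
  reduced-increasing (m ∷ M′) reduced =
    AllPairs-traj⁻ (m ∷ M′) T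
      (PreFork-traj-⊏ M′ (abundant-acyclic⇒PreFork isT abT acT (interior-in m M′ reduced) (interior-out m M′ reduced))
                         (Linked-++⁻ʳ S (Linked-++⁻ʳ (reverse (m ∷ M′)) reduced)))

module Distinctness {n k : ℕ} {T : Arrows n} (isT : IsQuiver T) (abT : Abundantʷ T) (acT : Acyclic T)
                    {S : List (Fin n)} (ord : Ordered T S) (cover : ∀ x → x ∈ S)
                    (M : List (Fin n)) (reduced : Linked _≢_ (reverse M ++ S ++ M))
                    (A : Fin n → Fin k → ℕ) {t₀ : Fin n} {h₀ : Fin k} (A>0 : 0 < A t₀ h₀) where

  open Extension {n} {k}
  open SourceSequenceMutation isT ord cover
  open ReducedSequence isT abT acT ord cover
  open SourceSequenceOnColumn isT abT ord cover h₀

  X₀ : Arrows (n + k)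
  X₀ = glue (μs M T) (I k) A

  eM eS : List (Fin (n + k))
  eM = map mutable M
  eS = map mutable S

  Y Y′ : Arrows (n + k)
  Y  = μs (reverse eM) X₀
  Y′ = μs eS Y

  isX₀ : IsQuiver X₀
  isX₀ = glue-isQuiver (μs M T) (I k) A (μs-isQuiver M isT) (I-isQuiver k)

  isY : IsQuiver Y
  isY = μs-isQuiver (reverse eM) isX₀

  R : ℕ → Arrows n
  R r = μs (take r M) T

  mutablePart-Y : mutablePart Y ≈Q T
  mutablePart-Y =
    subst (λ L → mutablePart (μs L X₀) ≈Q T) (reverse-map mutable M)
      (≈Q-trans (mutablePart-μs (reverse M) X₀)
                (≈Q-trans (μs-cong (reverse M) (glue-mutable (μs M T) (I k) A)) (μs-reverse∘μs M isT)))

  mutablePart-Y′ : mutablePart Y′ ≈Q T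
  mutablePart-Y′ = ≈Q-trans (mutablePart-μs S Y)
    (≈Q-trans (μs-cong S mutablePart-Y)
              (≈Q-trans (μs-reverseCut [] S {[]} (sym (++-identityʳ S))) reverseCut-complete))

  column-of-Y-nonzero : ¬ (∀ t → Detached Y t h₀)
  column-of-Y-nonzero detachedY = contradiction A≡0 (m<n⇒n≢0 A>0)
    where
    back : SameColumn h₀ (μs eM Y) Y
    back = μs-detached M isY (λ t _ → detachedY t)
    A≡0 : A t₀ h₀ ≡ 0
    A≡0 = trans (sym (glue-to-frozen (μs M T) (I k) A t₀ h₀))
                (trans (sym (μs∘μs-reverse eM isX₀ (mutable t₀) (frozen h₀)))
                       (trans (SameColumn.same-to back t₀) (Detached.no-arrow-to (detachedY t₀))))

  frozen-condition : ∀ M₀ → Linked _≢_ (reverse M₀ ++ S ++ M₀) →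
                     FrozenCondition [] (μs (reverse (map mutable M₀)) (glue (μs M₀ T) (I k) A))
  frozen-condition []        _        = inj₂ λ t _ → glue-from-frozen T (I k) A h₀ t
  frozen-condition (m ∷ M′) reduced₀ = inj₁ (interior-ThreeDistinct m M′ reduced₀)

  Y≉Y′ : Y ≉Q Y′
  Y≉Y′ = μs-moves-column isY mutablePart-Y column-of-Y-nonzero (frozen-condition M reduced)

  isY′ : IsQuiver Y′
  isY′ = μs-isQuiver eS isY

  -- Up to ≈Q, the trajectory of M⁻¹ S M from X₀ is Z |M|, …, Z 0, then W 1, …, W |S| = Y′, then Z′ 1, …, Z′ |M|.
  Z Z′ W : ℕ → Arrows (n + k)
  Z r  = μs (take r eM) Y
  Z′ r = μs (take r eM) Y′
  W j  = μs (take j eS) Y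

  mutablePart-Z : ∀ r → mutablePart (Z r) ≈Q R r
  mutablePart-Z r = ≈Q-trans (mutablePart-μs-take M r Y) (μs-cong (take r M) mutablePart-Y)

  mutablePart-Z′ : ∀ r → mutablePart (Z′ r) ≈Q R r
  mutablePart-Z′ r = ≈Q-trans (mutablePart-μs-take M r Y′) (μs-cong (take r M) mutablePart-Y′)

  mutablePart-W : ∀ j → mutablePart (W j) ≈Q reverseCut (take j S) T
  mutablePart-W j = ≈Q-trans (mutablePart-μs-take S j Y) (≈Q-trans (μs-cong (take j S) mutablePart-Y) (μs-take-reverseCut j))

  R-increasing : ∀ r r′ → r < r′ → r′ ≤ length M → R r ⊏ R r′
  R-increasing = reduced-increasing M reduced

  reverseCut⊏R : ∀ P {r} → 0 < r → r ≤ length M → reverseCut P T ⊏ R r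
  reverseCut⊏R P 0<r r≤ = ⊏-respˡ-weight (λ x y → sym (reverseCut-weight P T x y)) (R-increasing 0 _ 0<r r≤)

  Z≉Z : ∀ {p p′} → p < p′ → p′ ≤ length M → Z p ≉Q Z p′
  Z≉Z {p} {p′} p<p′ p′≤ = mutablePart-≉ (mutablePart-Z p) (mutablePart-Z p′) (⊏⇒≉ (R-increasing p p′ p<p′ p′≤))

  Z′≉Z′ : ∀ {p p′} → p < p′ → p′ ≤ length M → Z′ p ≉Q Z′ p′
  Z′≉Z′ {p} {p′} p<p′ p′≤ = mutablePart-≉ (mutablePart-Z′ p) (mutablePart-Z′ p′) (⊏⇒≉ (R-increasing p p′ p<p′ p′≤))

  Z≉Z′ : ∀ {p r} → p ≤ length M → r ≤ length M → Z p ≉Q Z′ r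
  Z≉Z′ {p} {r} p≤ r≤ with <-cmp p r
  ... | tri< p<r _ _ = mutablePart-≉ (mutablePart-Z p) (mutablePart-Z′ r) (⊏⇒≉ (R-increasing p r p<r r≤))
  ... | tri> _ _ r<p = mutablePart-≉ (mutablePart-Z p) (mutablePart-Z′ r) (≉Q-sym (⊏⇒≉ (R-increasing r p r<p p≤)))
  ... | tri≈ _ refl _ = λ Zp≈Z′p → Y≉Y′ (μs-injective (take p eM) isY isY′ Zp≈Z′p)

  W≉W : ∀ {j j′} → 0 < j → j < j′ → j′ ≤ length S → W j ≉Q W j′
  W≉W {j} {j′} 0<j j<j′ j′≤ = mutablePart-≉ (mutablePart-W j) (mutablePart-W j′) (reverseCut-take-≉ 0<j j<j′ j′≤)

  W≉Z′ : ∀ j {r} → 0 < r → r ≤ length M → W j ≉Q Z′ r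
  W≉Z′ j {r} 0<r r≤ = mutablePart-≉ (mutablePart-W j) (mutablePart-Z′ r) (⊏⇒≉ (reverseCut⊏R (take j S) 0<r r≤))

  Z≉W : ∀ {p j} → p ≤ length M → 0 < j → j ≤ length S → Z p ≉Q W j
  Z≉W {suc p} {j} p≤ _ _ = mutablePart-≉ (mutablePart-Z (suc p)) (mutablePart-W j)
                                          (≉Q-sym (⊏⇒≉ (reverseCut⊏R (take j S) (s≤s z≤n) p≤)))
  Z≉W {zero} {j} _ 0<j j≤ with m≤n⇒m<n∨m≡n j≤
  ... | inj₁ j<|S| = mutablePart-≉ mutablePart-Y (mutablePart-W j) (≉-reverseCut-take 0<j j<|S|)
  ... | inj₂ refl = λ Y≈W → Y≉Y′ (subst (λ L → Y ≈Q μs L Y) (take-all (length S) eS (≤-reflexive (length-map mutable S))) Y≈W)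

  trajectory-split : traj (map mutable (reverse M ++ S ++ M)) X₀ ≡ traj (reverse eM) X₀ ++ (traj⁺ eS Y ++ traj⁺ eM Y′)
  trajectory-split = begin
    traj (map mutable (reverse M ++ S ++ M)) X₀
      ≡⟨ cong (λ L → traj L X₀) (trans (map-++ mutable (reverse M) (S ++ M))
                                       (cong₂ _++_ (reverse-map mutable M) (map-++ mutable S M))) ⟩
    traj (reverse eM ++ eS ++ eM) X₀
      ≡⟨ traj-++ (reverse eM) (eS ++ eM) X₀ ⟩
    traj (reverse eM) X₀ ++ traj⁺ (eS ++ eM) Y
      ≡⟨ cong (traj (reverse eM) X₀ ++_) (traj⁺-++ eS eM Y) ⟩
    traj (reverse eM) X₀ ++ (traj⁺ eS Y ++ traj⁺ eM Y′) ∎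
    where open ≡-Reasoning

  trajectory-distinct : AllPairs _≉Q_ (traj (map mutable (reverse M ++ S ++ M)) X₀)
  trajectory-distinct =
    subst (AllPairs _≉Q_) (sym trajectory-split)
          (AllPairs-++⁺ before-S (AllPairs-++⁺ along-S after-S along-S-vs-after-S) before-S-vs-rest)
    where
    |eM| : length eM ≡ length M
    |eM| = length-map mutable M
    |eS| : length eS ≡ length S
    |eS| = length-map mutable S
    before-S : AllPairs _≉Q_ (traj (reverse eM) X₀)
    before-S = traj-reverse-AllPairs ≉Q-resp eM isX₀ λ p p′ p<p′ p′≤ →
      ≉Q-sym (Z≉Z p<p′ (subst (p′ ≤_) |eM| p′≤))
    along-S : AllPairs _≉Q_ (traj⁺ eS Y)
    along-S = traj⁺-AllPairs eS Y λ q q′ q<q′ q′< →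
      W≉W (s≤s z≤n) (s≤s q<q′) (subst (q′ <_) |eS| q′<)
    after-S : AllPairs _≉Q_ (traj⁺ eM Y′)
    after-S = traj⁺-AllPairs eM Y′ λ q q′ q<q′ q′< →
      Z′≉Z′ (s≤s q<q′) (subst (q′ <_) |eM| q′<)
    along-S-vs-after-S : All (λ X → All (X ≉Q_) (traj⁺ eM Y′)) (traj⁺ eS Y)
    along-S-vs-after-S = traj⁺-All eS Y λ j _ → traj⁺-All eM Y′ λ r r< →
      W≉Z′ (suc j) (s≤s z≤n) (subst (r <_) |eM| r<)
    before-S-vs-rest : All (λ X → All (X ≉Q_) (traj⁺ eS Y ++ traj⁺ eM Y′)) (traj (reverse eM) X₀)
    before-S-vs-rest = traj-reverse-All (λ X≈Z → All.map (≉Q-resp X≈Z ≈Q-refl)) eM isX₀ λ p p≤ →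
      let p≤M = subst (p ≤_) |eM| p≤
      in  All-++⁺ (traj⁺-All eS Y λ j j< → Z≉W p≤M (s≤s z≤n) (subst (j <_) |eS| j<))
                  (traj⁺-All eM Y′ λ r r< → Z≉Z′ p≤M (subst (r <_) |eM| r<))

lemma4p22 : (n : ℕ) (T : Arrows n) → IsQuiver T → Abundant T → Acyclic T →
    (S : List (Fin n)) → ReddeningSourceSequence T S →
    (M : List (Fin n)) → Reduced (reverse M ++ S ++ M) →
    (k : ℕ) (A : Fin n → Fin k → ℕ) → NonzeroMat A →
    Distinguishing (μs M T) (reverse M ++ S ++ M) A
lemma4p22 n T isT abT acT S (source , reddening) M reduced k A (t₀ , h₀ , A>0) =
  Distinctness.trajectory-distinct isT abʷ acT ordered (reddening⇒covers isT reddening) M reduced A A>0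
  where
  abʷ = Abundant⇒Abundantʷ isT abT
  ordered = no-back-arrows⇒Ordered isT abʷ (sourceSequence⇒no-back-arrows isT S source)
                                   (Linked-++⁻ˡ S (Linked-++⁻ʳ (reverse M) reduced))
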